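{- Let $d\in\mathbb{Z}_{>0}$ and $\mu\in\Lambda_{\le p^d}$. Let $\theta,\theta'\in\mathrm{Der}_S$ be of the form $\theta=fx^{\mu_1}\partial_x+gy^{\mu_2}\partial_y$ and $\theta'=f'x^{\mu_1}\partial_x+g'y^{\mu_2}\partial_y$ with $f,g,f',g'\in S$. Then the following are equivalent: (i) $\{\theta,\theta'\}$ is a basis for $D(\mathcal{A},\mu)$; (ii) $\{\theta^\vee,\theta'^\vee\}$ is a basis for $D(\mathcal{A},\mu^\vee)$. Furthermore, $\Delta(\mu)=\Delta(\mu^\vee)$.
   Context: Let $p$ be a prime, $\mathbb{F}=\mathbb{F}_p$, $S=\mathbb{F}[x,y]$, $\mathrm{Der}_S=S\partial_x\oplus S\partial_y$. Let $\mathcal{A}=\{H_1,H_2,H_3\}$ with $H_1=\ker x$, $H_2=\ker y$, $H_3=\ker(x+y)$, $\alpha_1=x,\alpha_2=y,\alpha_3=x+y$. For $\mu=(\mu_1,\mu_2,\mu_3)\in\Lambda\coloneqq\mathbb{Z}_{\ge0}^3$, $D(\mathcal{A},\mu)=\{\theta\in\mathrm{Der}_S:\theta(\alpha_i)\in\alpha_i^{\mu_i}S,\ i=1,2,3\}$; it is a free $S$-module of rank 2 with a homogeneous basis whose degrees (the exponents) are unique up to order; $\Delta(\mu)$ is the absolute difference of the two exponents. $\Lambda_{\le p^d}=\{\mu\in\Lambda:\mu_1,\mu_2,\mu_3\le p^d\}$, and for $\mu\in\Lambda_{\le p^d}$, $\mu^\vee=(p^d-\mu_1,\,p^d-\mu_2,\,\mu_3)$.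 For $\theta=fx^{\mu_1}\partial_x+gy^{\mu_2}\partial_y$ ($f,g\in S$), define $\theta^\vee=gx^{p^d-\mu_1}\partial_x-fy^{p^d-\mu_2}\partial_y$. -}

module Defs where

open import Data.Nat using (ℕ; zero; suc; _∸_; _^_; _≡ᵇ_; ∣_-_∣) renaming (_+_ to _+ℕ_; _≤_ to _≤ℕ_)
open import Data.Integer using (ℤ; +_; -_; _-_) renaming (_+_ to _+ℤ_; _*_ to _*ℤ_)
open import Data.Integer.Divisibility using (_∣_)
open import Data.Bool using (if_then_else_; _∧_)
open import Data.Product using (Σ; _×_; _,_; proj₁; proj₂)
open import Relation.Binary.PropositionalEquality using (_≡_)
open import Relation.Nullary using (¬_)

-- Elements of S = F_p[x,y] are represented by integer coefficient functions
-- (coefficient of x^i y^j), read modulo p, with finite support modulo p.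
Ser : Set
Ser = ℕ → ℕ → ℤ

sumTo : ℕ → (ℕ → ℤ) → ℤ
sumTo zero    f = + 0
sumTo (suc n) f = sumTo n f +ℤ f n

0S : Ser
0S i j = + 0

1S : Ser
1S i j = if (i ≡ᵇ 0) ∧ (j ≡ᵇ 0) then + 1 else + 0

X : Ser
X i j = if (i ≡ᵇ 1) ∧ (j ≡ᵇ 0) then + 1 else + 0

Y : Ser
Y i j = if (i ≡ᵇ 0) ∧ (j ≡ᵇ 1) then + 1 else + 0

infixl 6 _⊕_
infixl 7 _⊛_

_⊕_ : Ser → Ser → Ser
(f ⊕ g) i j = f i j +ℤ g i j

⊖_ : Ser → Ser
(⊖ f) i j = - f i j

_⊛_ : Ser → Ser → Ser
(f ⊛ g) i j = sumTo (suc i) λ a → sumTo (suc j) λ b → f a b *ℤ g (i ∸ a) (j ∸ b)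

pow : Ser → ℕ → Ser
pow f zero    = 1S
pow f (suc n) = f ⊛ pow f n

IsPoly : ℕ → Ser → Set
IsPoly p f = Σ ℕ λ N → ∀ i j → N ≤ℕ i +ℕ j → (+ p) ∣ f i j

_≈[_]_ : Ser → ℕ → Ser → Set
f ≈[ p ] g = ∀ i j → (+ p) ∣ (f i j - g i j)

DivS : ℕ → Ser → Ser → Set
DivS p a f = Σ Ser λ q → IsPoly p q × (f ≈[ p ] (a ⊛ q))

-- derivations P ∂x + Q ∂y  represented by (P , Q)
Der : Set
Der = Ser × Ser

IsDer : ℕ → Der → Set
IsDer p (P , Q) = IsPoly p P × IsPoly p Q

_≈D[_]_ : Der → ℕ → Der → Set
(P , Q) ≈D[ p ] (P' , Q') = (P ≈[ p ] P') × (Q ≈[ p ] Q')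

_+D_ : Der → Der → Der
(P , Q) +D (P' , Q') = (P ⊕ P' , Q ⊕ Q')

_·D_ : Ser → Der → Der
a ·D (P , Q) = (a ⊛ P , a ⊛ Q)

0D : Der
0D = (0S , 0S)

Mult : Set
Mult = ℕ × ℕ × ℕ

InD : ℕ → Mult → Der → Set
InD p (μ₁ , μ₂ , μ₃) (P , Q) =
  IsDer p (P , Q) × DivS p (pow X μ₁) P × DivS p (pow Y μ₂) Q × DivS p (pow (X ⊕ Y) μ₃) (P ⊕ Q)

IsBasis : ℕ → Mult → Der → Der → Set
IsBasis p μ θ θ' =
  InD p μ θ × InD p μ θ' ×
  (∀ η → InD p μ η → Σ Ser λ a → Σ Ser λ b → IsPoly p a × IsPoly p b × (η ≈D[ p ] ((a ·D θ) +D (b ·D θ')))) ×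
  (∀ a b → IsPoly p a → IsPoly p b → ((a ·D θ) +D (b ·D θ')) ≈D[ p ] 0D → (a ≈[ p ] 0S) × (b ≈[ p ] 0S))

HomogDeg : ℕ → Der → ℕ → Set
HomogDeg p (P , Q) k = ∀ i j → ¬ (i +ℕ j ≡ k) → ((+ p) ∣ P i j) × ((+ p) ∣ Q i j)

dualMult : ℕ → ℕ → Mult → Mult
dualMult p d (μ₁ , μ₂ , μ₃) = (p ^ d ∸ μ₁ , p ^ d ∸ μ₂ , μ₃)

mkθ : Mult → Ser → Ser → Der
mkθ (μ₁ , μ₂ , μ₃) f g = (pow X μ₁ ⊛ f , pow Y μ₂ ⊛ g)

mkθ∨ : ℕ → ℕ → Mult → Ser → Ser → Der
mkθ∨ p d (μ₁ , μ₂ , μ₃) f g = (pow X (p ^ d ∸ μ₁) ⊛ g , ⊖ (pow Y (p ^ d ∸ μ₂) ⊛ f))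

InBox : ℕ → ℕ → Mult → Set
InBox p d (μ₁ , μ₂ , μ₃) = (μ₁ ≤ℕ p ^ d) × (μ₂ ≤ℕ p ^ d) × (μ₃ ≤ℕ p ^ d)

-- Δ(μ) = Δ(ν): the exponent difference of any homogeneous basis of D(A,μ)
-- equals that of any homogeneous basis of D(A,ν)
SameΔ : ℕ → Mult → Mult → Set
SameΔ p μ ν =
  ∀ θ₁ θ₂ k₁ k₂ η₁ η₂ l₁ l₂ →
  IsBasis p μ θ₁ θ₂ → HomogDeg p θ₁ k₁ → HomogDeg p θ₂ k₂ →
  IsBasis p ν η₁ η₂ → HomogDeg p η₁ l₁ → HomogDeg p η₂ l₂ →
  ∣ k₁ - k₂ ∣ ≡ ∣ l₁ - l₂ ∣

module Submission where

-- The conditions at x and y hold automatically, so θ ∈ D(A, μ)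
-- exactly when (x+y)^μ₃ divides x^μ₁ f + y^μ₂ g.  Over F_p, (x+y)^N = x^N + y^N for N = p^d, whence
--   x^μ₁ (x^(N-μ₁) g - y^(N-μ₂) f) = (x+y)^N g - y^(N-μ₂) (x^μ₁ f + y^μ₂ g),
-- and since x is prime to x+y, (x+y)^μ₃ divides x^(N-μ₁) g - y^(N-μ₂) f, i.e. θ^∨ ∈ D(A, μ^∨).
-- The map (f, g) ↦ (g, -f) is linear with square -1, and the monomial factors x^μ₁, y^μ₂ cancel, so it
-- carries bases of D(A, μ) to bases of D(A, μ^∨) and back.  It shifts degrees of homogeneous elements by
-- N - μ₁ - μ₂, while the degrees of a homogeneous basis are intrinsic: the smaller one is the least degree
-- of a nonzero homogeneous element, and below the larger one every homogeneous element is a multiple of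
-- the first basis element.

open import Defs
open import Algebra.Bundles using (CommutativeRing)
open import Algebra.Solver.Ring.AlmostCommutativeRing using (_-Raw-AlmostCommutative⟶_; fromCommutativeRing)
open import Data.Bool using (true; false; if_then_else_; _∧_)
open import Data.Bool.Properties using (T-≡)
open import Data.Empty using (⊥; ⊥-elim)
open import Data.Integer using (ℤ; +-*-rawRing; +_; -_; _-_) renaming (_+_ to _+ℤ_; _*_ to _*ℤ_)
open import Data.Integer.Divisibility using () renaming (_∣_ to _∣ᵤ_)
open import Data.Integer.Divisibility.Signed as Signed using (∣ᵤ⇒∣; ∣⇒∣ᵤ)
import Data.Integer.Properties as ℤ
open import Algebra.Properties.CommutativeSemigroup ℤ.+-commutativeSemigroup using (interchange)
import Data.Integer.Tactic.RingSolver as ℤ-Solver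
open import Data.Maybe using (Maybe; just; nothing)
open import Data.Nat
  using (ℕ; zero; suc; z≤n; s≤s; _+_; _*_; _∸_; _^_; _≤_; _<_; _≤?_; _≟_; _≡ᵇ_; _⊓_; _⊔_; ∣_-_∣; nonTrivial⇒≢1; ≢-nonZero⁻¹)
open import Data.Nat.Combinatorics using (_C_; nCk+nC[k+1]≡[n+1]C[k+1]; nC1≡n; nCn≡1)
open import Data.Nat.Combinatorics.Specification using (k>n⇒nCk≡0)
open import Data.Nat.Divisibility using (_∣_; _∣?_; divides; 1∣_; _∣0; m∣m*n; ∣-trans; *-monoʳ-∣; *-cancelˡ-∣; ∣⇒≤; ∣1⇒≡1)
open import Data.Nat.Primality using (Prime; euclidsLemma; prime⇒nonZero; prime⇒nonTrivial)
open import Data.Nat.Properties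
  using (≤-refl; ≤-pred; ≤-<-trans; <-≤-trans; m≤n⇒m≤1+n; +-∸-assoc; n∸n≡0; m∸[m∸n]≡n; ∸-+-assoc; m+[n∸m]≡n; m+n∸m≡n;
         ≡ᵇ⇒≡; ≡⇒≡ᵇ; <-irrefl; ≤∧≢⇒<; m≤m+n; <⇒≢; +-suc; +-identityʳ; ≤-reflexive; +-comm; *-comm; *-zeroʳ;
         *-identityʳ; <⇒≱; ≤-total; m≤n⇒m⊔n≡n; m≤n⇒m⊓n≡m; m≥n⇒m⊔n≡m; m≥n⇒m⊓n≡n; m≤n⇒∣m-n∣≡n∸m; ∣-∣-comm;
         ∣m+n-m+o∣≡∣n-o∣; +-assoc; m∸n+n≡m; m+n∸n≡m; m≤m⊔n; m≤n⊔m; ≤-antisym; ⊓-glb; ⊔-lub; m⊓n≤m; m⊓n≤n; m∸n≤m;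
         m^n≢0; m<m+n; ≤-trans; <⇒≤; ≰⇒>; m≤n+m; +-monoˡ-≤; +-cancelˡ-≤; module ≤-Reasoning)
import Data.Nat.Tactic.RingSolver as ℕ-Solver
open import Data.Product using (Σ; _×_; _,_; proj₁; proj₂; swap)
open import Data.Sum using (_⊎_; inj₁; inj₂)
open import Function using (_∘_; Equivalence)
open import Function.Bundles using (_⇔_; mk⇔)
import Relation.Binary.Reasoning.Setoid as SetoidReasoning
open import Relation.Binary.PropositionalEquality
open import Relation.Nullary using (¬_; yes; no)

[1+k]*[1+n]C[1+k]≡[1+n]*nCk : ∀ n k → suc k * (suc n C suc k) ≡ suc n * (n C k)
[1+k]*[1+n]C[1+k]≡[1+n]*nCk zero    zero    = refl
[1+k]*[1+n]C[1+k]≡[1+n]*nCk zero    (suc k) =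
  trans (cong (suc (suc k) *_) (k>n⇒nCk≡0 {1} {suc (suc k)} (s≤s (s≤s z≤n)))) (*-zeroʳ (suc (suc k)))
[1+k]*[1+n]C[1+k]≡[1+n]*nCk (suc n) zero    =
  trans (+-identityʳ _) (trans (nC1≡n (suc (suc n))) (sym (*-identityʳ (suc (suc n)))))
[1+k]*[1+n]C[1+k]≡[1+n]*nCk (suc n) (suc k) = begin
  suc (suc k) * (suc (suc n) C suc (suc k))          ≡⟨ cong (suc (suc k) *_) (nCk+nC[k+1]≡[n+1]C[k+1] (suc n) (suc k)) ⟨
  suc (suc k) * (B₁ + B₂)                             ≡⟨ expand (suc k) B₁ B₂ ⟩
  B₁ + suc k * B₁ + suc (suc k) * B₂                  ≡⟨ cong₂ (λ u v → B₁ + u + v) ([1+k]*[1+n]C[1+k]≡[1+n]*nCk n k)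
                                                                                ([1+k]*[1+n]C[1+k]≡[1+n]*nCk n (suc k)) ⟩
  B₁ + suc n * (n C k) + suc n * (n C suc k)          ≡⟨ collect n B₁ (n C k) (n C suc k) ⟩
  B₁ + suc n * (n C k + n C suc k)                    ≡⟨ cong (λ c → B₁ + suc n * c) (nCk+nC[k+1]≡[n+1]C[k+1] n k) ⟩
  B₁ + suc n * B₁                                     ∎
  where
  open ≡-Reasoning
  B₁ = suc n C suc k
  B₂ = suc n C suc (suc k)
  expand : ∀ k x y → suc k * (x + y) ≡ x + k * x + suc k * y
  expand = ℕ-Solver.solve-∀
  collect : ∀ n b x y → b + suc n * x + suc n * y ≡ b + suc n * (x + y)
  collect = ℕ-Solver.solve-∀

p^d∣m*c⇒p^d∣m : ∀ {p c} → Prime p → ¬ p ∣ c → ∀ d {m} → p ^ d ∣ m * c → p ^ d ∣ m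
p^d∣m*c⇒p^d∣m p-prime p∤c zero    {m} _ = 1∣ m
p^d∣m*c⇒p^d∣m {p} {c} p-prime p∤c (suc d) {m} p^[1+d]∣mc
  with euclidsLemma m c p-prime (∣-trans (m∣m*n (p ^ d)) p^[1+d]∣mc)
... | inj₂ p∣c = ⊥-elim (p∤c p∣c)
... | inj₁ (divides q refl) =
  subst (p ^ suc d ∣_) (*-comm p q) (*-monoʳ-∣ p (p^d∣m*c⇒p^d∣m p-prime p∤c d p^d∣qc))
  where
  instance _ = prime⇒nonZero p-prime
  p^d∣qc : p ^ d ∣ q * c
  p^d∣qc = *-cancelˡ-∣ p (subst (p ^ suc d ∣_) (reassoc q p c) p^[1+d]∣mc)
    where
    reassoc : ∀ q p c → q * p * c ≡ p * (q * c)
    reassoc = ℕ-Solver.solve-∀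

n∣k*nCk : ∀ n k → n ∣ k * (n C k)
n∣k*nCk n       zero    = n ∣0
n∣k*nCk zero    (suc k) = subst (0 ∣_) (sym (*-zeroʳ (suc k))) (0 ∣0)
n∣k*nCk (suc n) (suc k) = divides (n C k) (trans ([1+k]*[1+n]C[1+k]≡[1+n]*nCk n k) (*-comm (suc n) (n C k)))

-- p^d divides k C(p^d, k) but not k.
prime∣[p^d]Ck : ∀ {p} → Prime p → ∀ d k → 0 < k → k < p ^ d → p ∣ (p ^ d) C k
prime∣[p^d]Ck {p} p-prime d (suc k) _ 1+k<p^d with p ∣? (p ^ d) C suc k
... | yes p∣C = p∣C
... | no  p∤C = ⊥-elim (<⇒≱ 1+k<p^d (∣⇒≤ (p^d∣m*c⇒p^d∣m p-prime p∤C d (n∣k*nCk (p ^ d) (suc k)))))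

∣m-n∣≡m⊔n∸m⊓n : ∀ m n → ∣ m - n ∣ ≡ m ⊔ n ∸ m ⊓ n
∣m-n∣≡m⊔n∸m⊓n m n with ≤-total m n
... | inj₁ m≤n rewrite m≤n⇒m⊔n≡n m≤n | m≤n⇒m⊓n≡m m≤n = m≤n⇒∣m-n∣≡n∸m m≤n
... | inj₂ n≤m rewrite m≥n⇒m⊔n≡m n≤m | m≥n⇒m⊓n≡n n≤m = trans (∣-∣-comm m n) (m≤n⇒∣m-n∣≡n∸m n≤m)

∣m+o-n+o∣≡∣m-n∣ : ∀ o m n → ∣ m + o - n + o ∣ ≡ ∣ m - n ∣
∣m+o-n+o∣≡∣m-n∣ o m n = trans (cong₂ ∣_-_∣ (+-comm m o) (+-comm n o)) (∣m+n-m+o∣≡∣n-o∣ o m n)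

[a+b]+[i∸a+j∸b]≡i+j : ∀ {a b i j} → a ≤ i → b ≤ j → a + b + (i ∸ a + (j ∸ b)) ≡ i + j
[a+b]+[i∸a+j∸b]≡i+j {a} {b} {i} {j} a≤i b≤j =
  trans (regroup a b (i ∸ a) (j ∸ b)) (cong₂ _+_ (m+[n∸m]≡n a≤i) (m+[n∸m]≡n b≤j))
  where
  regroup : ∀ a b c d → a + b + (c + d) ≡ a + c + (b + d)
  regroup = ℕ-Solver.solve-∀

-- Finite sums and convolution of coefficient arrays

sumTo-cong : ∀ n {f g : ℕ → ℤ} → (∀ a → a < n → f a ≡ g a) → sumTo n f ≡ sumTo n g
sumTo-cong zero    f≡g = refl
sumTo-cong (suc n) f≡g = cong₂ _+ℤ_ (sumTo-cong n (λ a a<n → f≡g a (m≤n⇒m≤1+n a<n))) (f≡g n ≤-refl)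

sumTo-zero : ∀ n {f : ℕ → ℤ} → (∀ a → a < n → f a ≡ + 0) → sumTo n f ≡ + 0
sumTo-zero zero    f≡0 = refl
sumTo-zero (suc n) f≡0 = cong₂ _+ℤ_ (sumTo-zero n (λ a a<n → f≡0 a (m≤n⇒m≤1+n a<n))) (f≡0 n ≤-refl)

sumTo-single : ∀ n k {f : ℕ → ℤ} → k < n → (∀ a → a < n → a ≢ k → f a ≡ + 0) → sumTo n f ≡ f k
sumTo-single (suc n) k {f} k<1+n f≡0 with k ≟ n
... | yes refl = trans (cong (_+ℤ f k) (sumTo-zero n λ a a<n → f≡0 a (m≤n⇒m≤1+n a<n) (<⇒≢ a<n)))
                       (ℤ.+-identityˡ (f k))
... | no k≢n = trans (cong₂ _+ℤ_ (sumTo-single n k (≤∧≢⇒< (≤-pred k<1+n) k≢n) (λ a a<n → f≡0 a (m≤n⇒m≤1+n a<n)))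
                                 (f≡0 n ≤-refl (k≢n ∘ sym)))
                     (ℤ.+-identityʳ (f k))

sumTo-+ : ∀ n (f g : ℕ → ℤ) → sumTo n (λ a → f a +ℤ g a) ≡ sumTo n f +ℤ sumTo n g
sumTo-+ zero    f g = refl
sumTo-+ (suc n) f g = trans (cong (_+ℤ (f n +ℤ g n)) (sumTo-+ n f g)) (interchange (sumTo n f) (sumTo n g) (f n) (g n))

sumTo-*ˡ : ∀ n c (f : ℕ → ℤ) → c *ℤ sumTo n f ≡ sumTo n (λ a → c *ℤ f a)
sumTo-*ˡ zero    c f = ℤ.*-zeroʳ c
sumTo-*ˡ (suc n) c f = trans (ℤ.*-distribˡ-+ c (sumTo n f) (f n)) (cong (_+ℤ c *ℤ f n) (sumTo-*ˡ n c f))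

sumTo-*ʳ : ∀ n c (f : ℕ → ℤ) → sumTo n f *ℤ c ≡ sumTo n (λ a → f a *ℤ c)
sumTo-*ʳ n c f = trans (ℤ.*-comm (sumTo n f) c)
                       (trans (sumTo-*ˡ n c f) (sumTo-cong n λ a _ → ℤ.*-comm c (f a)))

sumTo-head : ∀ n (f : ℕ → ℤ) → sumTo (suc n) f ≡ f 0 +ℤ sumTo n (f ∘ suc)
sumTo-head zero    f = ℤ.+-comm (+ 0) (f 0)
sumTo-head (suc n) f =
  trans (cong (_+ℤ f (suc n)) (sumTo-head n f)) (ℤ.+-assoc (f 0) (sumTo n (f ∘ suc)) (f (suc n)))

sumTo-comm : ∀ m n (F : ℕ → ℕ → ℤ) →
  sumTo m (λ a → sumTo n (F a)) ≡ sumTo n (λ b → sumTo m (λ a → F a b))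
sumTo-comm zero    n F = sym (sumTo-zero n λ _ _ → refl)
sumTo-comm (suc m) n F =
  trans (cong (_+ℤ sumTo n (F m)) (sumTo-comm m n F)) (sym (sumTo-+ n (λ b → sumTo m (λ a → F a b)) (F m)))

sumTo-reverse : ∀ n (f : ℕ → ℤ) → sumTo (suc n) f ≡ sumTo (suc n) (λ a → f (n ∸ a))
sumTo-reverse zero    f = refl
sumTo-reverse (suc n) f = begin
  sumTo (suc n) f +ℤ f (suc n)                   ≡⟨ cong (_+ℤ f (suc n)) (sumTo-reverse n f) ⟩
  sumTo (suc n) (λ a → f (n ∸ a)) +ℤ f (suc n)   ≡⟨ ℤ.+-comm _ (f (suc n)) ⟩
  f (suc n) +ℤ sumTo (suc n) (λ a → f (n ∸ a))   ≡⟨ sumTo-head (suc n) (λ a → f (suc n ∸ a)) ⟨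
  sumTo (suc (suc n)) (λ a → f (suc n ∸ a))      ∎
  where open ≡-Reasoning

-- Both sides sum ψ a c over the triangle a + c ≤ n; on the right, u = a + c.
sumTo-triangle : ∀ n (ψ : ℕ → ℕ → ℤ) →
  sumTo (suc n) (λ a → sumTo (suc (n ∸ a)) (ψ a)) ≡ sumTo (suc n) (λ u → sumTo (suc u) (λ a → ψ a (u ∸ a)))
sumTo-triangle zero    ψ = refl
sumTo-triangle (suc n) ψ = begin
  sumTo (suc n) (λ a → sumTo (suc (suc n ∸ a)) (ψ a)) +ℤ sumTo (suc (n ∸ n)) (ψ (suc n))
    ≡⟨ cong₂ _+ℤ_ (sumTo-cong (suc n) peel) (singleton (n∸n≡0 n)) ⟩
  sumTo (suc n) (λ a → sumTo (suc (n ∸ a)) (ψ a) +ℤ ψ a (suc n ∸ a)) +ℤ ψ (suc n) (n ∸ n)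
    ≡⟨ cong (_+ℤ ψ (suc n) (n ∸ n)) (sumTo-+ (suc n) _ _) ⟩
  (S +ℤ sumTo (suc n) (λ a → ψ a (suc n ∸ a))) +ℤ ψ (suc n) (n ∸ n)
    ≡⟨ ℤ.+-assoc S (sumTo (suc n) (λ a → ψ a (suc n ∸ a))) (ψ (suc n) (n ∸ n)) ⟩
  S +ℤ sumTo (suc (suc n)) (λ a → ψ a (suc n ∸ a))
    ≡⟨ cong (_+ℤ sumTo (suc (suc n)) (λ a → ψ a (suc n ∸ a))) (sumTo-triangle n ψ) ⟩
  sumTo (suc n) (λ u → sumTo (suc u) (λ a → ψ a (u ∸ a))) +ℤ sumTo (suc (suc n)) (λ a → ψ a (suc n ∸ a))
    ∎
  where
  open ≡-Reasoning
  S = sumTo (suc n) (λ a → sumTo (suc (n ∸ a)) (ψ a))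
  peel : ∀ a → a < suc n → sumTo (suc (suc n ∸ a)) (ψ a) ≡ sumTo (suc (n ∸ a)) (ψ a) +ℤ ψ a (suc n ∸ a)
  peel a (s≤s a≤n) rewrite +-∸-assoc 1 a≤n = refl
  singleton : ∀ {k} → k ≡ 0 → sumTo (suc k) (ψ (suc n)) ≡ ψ (suc n) k
  singleton refl = ℤ.+-identityˡ _

infix 4 _≐_
_≐_ : Ser → Ser → Set
f ≐ g = ∀ i j → f i j ≡ g i j

⊛-congˡ : ∀ {f g} h → f ≐ g → f ⊛ h ≐ g ⊛ h
⊛-congˡ h f≐g i j = sumTo-cong (suc i) λ a _ → sumTo-cong (suc j) λ b _ → cong (_*ℤ h (i ∸ a) (j ∸ b)) (f≐g a b)

⊛-congʳ : ∀ h {f g} → f ≐ g → h ⊛ f ≐ h ⊛ g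
⊛-congʳ h f≐g i j = sumTo-cong (suc i) λ a _ → sumTo-cong (suc j) λ b _ → cong (h a b *ℤ_) (f≐g (i ∸ a) (j ∸ b))

⊛-comm : ∀ f g → f ⊛ g ≐ g ⊛ f
⊛-comm f g i j = begin
  sumTo (suc i) (λ a → sumTo (suc j) (λ b → f a b *ℤ g (i ∸ a) (j ∸ b)))
    ≡⟨ sumTo-reverse i _ ⟩
  sumTo (suc i) (λ a → sumTo (suc j) (λ b → f (i ∸ a) b *ℤ g (i ∸ (i ∸ a)) (j ∸ b)))
    ≡⟨ sumTo-cong (suc i) (λ a _ → sumTo-reverse j _) ⟩
  sumTo (suc i) (λ a → sumTo (suc j) (λ b → f (i ∸ a) (j ∸ b) *ℤ g (i ∸ (i ∸ a)) (j ∸ (j ∸ b))))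
    ≡⟨ sumTo-cong (suc i) (λ a a<1+i → sumTo-cong (suc j) (λ b b<1+j →
         trans (ℤ.*-comm (f (i ∸ a) (j ∸ b)) _)
               (cong₂ (λ a′ b′ → g a′ b′ *ℤ f (i ∸ a) (j ∸ b)) (m∸[m∸n]≡n (≤-pred a<1+i)) (m∸[m∸n]≡n (≤-pred b<1+j))))) ⟩
  sumTo (suc i) (λ a → sumTo (suc j) (λ b → g a b *ℤ f (i ∸ a) (j ∸ b)))
    ∎
  where open ≡-Reasoning

⊛-assoc : ∀ f g h → (f ⊛ g) ⊛ h ≐ f ⊛ (g ⊛ h)
⊛-assoc f g h i j = sym (begin
  sumTo (suc i) (λ a → sumTo (suc j) (λ b → f a b *ℤ
    sumTo (suc (i ∸ a)) (λ c → sumTo (suc (j ∸ b)) (λ e → g c e *ℤ h (i ∸ a ∸ c) (j ∸ b ∸ e)))))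
    ≡⟨ sumTo-cong (suc i) (λ a _ → sumTo-cong (suc j) (λ b _ →
         trans (sumTo-*ˡ (suc (i ∸ a)) (f a b) _) (sumTo-cong (suc (i ∸ a)) (λ c _ → sumTo-*ˡ (suc (j ∸ b)) (f a b) _)))) ⟩
  sumTo (suc i) (λ a → sumTo (suc j) (λ b → sumTo (suc (i ∸ a)) (λ c → sumTo (suc (j ∸ b)) (λ e → Φ a c b e))))
    ≡⟨ sumTo-cong (suc i) (λ a _ → sumTo-comm (suc j) (suc (i ∸ a)) _) ⟩
  sumTo (suc i) (λ a → sumTo (suc (i ∸ a)) (λ c → sumTo (suc j) (λ b → sumTo (suc (j ∸ b)) (λ e → Φ a c b e))))
    ≡⟨ sumTo-triangle i _ ⟩
  sumTo (suc i) (λ u → sumTo (suc u) (λ a → sumTo (suc j) (λ b → sumTo (suc (j ∸ b)) (λ e → Φ a (u ∸ a) b e))))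
    ≡⟨ sumTo-cong (suc i) (λ u _ → sumTo-cong (suc u) (λ a _ → sumTo-triangle j _)) ⟩
  sumTo (suc i) (λ u → sumTo (suc u) (λ a → sumTo (suc j) (λ v → sumTo (suc v) (λ b → Φ a (u ∸ a) b (v ∸ b)))))
    ≡⟨ sumTo-cong (suc i) (λ u _ → sumTo-comm (suc u) (suc j) _) ⟩
  sumTo (suc i) (λ u → sumTo (suc j) (λ v → sumTo (suc u) (λ a → sumTo (suc v) (λ b → Φ a (u ∸ a) b (v ∸ b)))))
    ≡⟨ sumTo-cong (suc i) (λ u _ → sumTo-cong (suc j) (λ v _ → sumTo-cong (suc u) (λ a a<1+u → sumTo-cong (suc v) (λ b b<1+v →
         trans (sym (ℤ.*-assoc (f a b) _ _))
               (cong₂ (λ i′ j′ → f a b *ℤ g (u ∸ a) (v ∸ b) *ℤ h i′ j′) (∸-∸ i (≤-pred a<1+u)) (∸-∸ j (≤-pred b<1+v))))))) ⟩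
  sumTo (suc i) (λ u → sumTo (suc j) (λ v → sumTo (suc u) (λ a → sumTo (suc v) (λ b →
    f a b *ℤ g (u ∸ a) (v ∸ b) *ℤ h (i ∸ u) (j ∸ v)))))
    ≡⟨ sumTo-cong (suc i) (λ u _ → sumTo-cong (suc j) (λ v _ → sym
         (trans (sumTo-*ʳ (suc u) (h (i ∸ u) (j ∸ v)) _) (sumTo-cong (suc u) (λ a _ → sumTo-*ʳ (suc v) (h (i ∸ u) (j ∸ v)) _))))) ⟩
  sumTo (suc i) (λ u → sumTo (suc j) (λ v → sumTo (suc u) (λ a → sumTo (suc v) (λ b →
    f a b *ℤ g (u ∸ a) (v ∸ b))) *ℤ h (i ∸ u) (j ∸ v)))
    ∎)
  where
  open ≡-Reasoning
  Φ : ℕ → ℕ → ℕ → ℕ → ℤ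
  Φ a c b e = f a b *ℤ (g c e *ℤ h (i ∸ a ∸ c) (j ∸ b ∸ e))
  ∸-∸ : ∀ n {a u} → a ≤ u → n ∸ a ∸ (u ∸ a) ≡ n ∸ u
  ∸-∸ n {a} {u} a≤u = trans (∸-+-assoc n a (u ∸ a)) (cong (n ∸_) (m+[n∸m]≡n a≤u))

⊛-distribʳ : ∀ f g h → (f ⊕ g) ⊛ h ≐ f ⊛ h ⊕ g ⊛ h
⊛-distribʳ f g h i j =
  trans (sumTo-cong (suc i) λ a _ →
           trans (sumTo-cong (suc j) λ b _ → ℤ.*-distribʳ-+ (h (i ∸ a) (j ∸ b)) (f a b) (g a b))
                 (sumTo-+ (suc j) _ _))
        (sumTo-+ (suc i) _ _)

-- X, Y and 1S are definitionally monomial 1 0, monomial 0 1 and monomial 0 0.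
monomial : ℕ → ℕ → Ser
monomial u v i j = if (i ≡ᵇ u) ∧ (j ≡ᵇ v) then + 1 else + 0

monomial-diag : ∀ u v → monomial u v u v ≡ + 1
monomial-diag u v rewrite Equivalence.to T-≡ (≡⇒≡ᵇ u u refl) | Equivalence.to T-≡ (≡⇒≡ᵇ v v refl) = refl

monomial-off : ∀ {u v} a b → ¬ (a ≡ u × b ≡ v) → monomial u v a b ≡ + 0
monomial-off {u} {v} a b ≢uv with a ≡ᵇ u in a≡ᵇu | b ≡ᵇ v in b≡ᵇv
... | false | _     = refl
... | true  | false = refl
... | true  | true  = ⊥-elim (≢uv (≡ᵇ⇒≡ a u (Equivalence.from T-≡ a≡ᵇu) , ≡ᵇ⇒≡ b v (Equivalence.from T-≡ b≡ᵇv)))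

monomial-off-* : ∀ {u v} a b → ¬ (a ≡ u × b ≡ v) → ∀ c → monomial u v a b *ℤ c ≡ + 0
monomial-off-* a b ≢uv c = trans (cong (_*ℤ c) (monomial-off a b ≢uv)) (ℤ.*-zeroˡ c)

monomial-at : ∀ {u v i j} → i ≡ u → j ≡ v → monomial u v i j ≡ + 1
monomial-at {u} {v} refl refl = monomial-diag u v

monomial⊛-shift : ∀ u v f i j → (monomial u v ⊛ f) (u + i) (v + j) ≡ f i j
monomial⊛-shift u v f i j = begin
  sumTo (suc (u + i)) (λ a → sumTo (suc (v + j)) (λ b → monomial u v a b *ℤ f (u + i ∸ a) (v + j ∸ b)))
    ≡⟨ sumTo-single (suc (u + i)) u (s≤s (m≤m+n u i)) (λ a _ a≢u →
         sumTo-zero (suc (v + j)) λ b _ → monomial-off-* a b (a≢u ∘ proj₁) _) ⟩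
  sumTo (suc (v + j)) (λ b → monomial u v u b *ℤ f (u + i ∸ u) (v + j ∸ b))
    ≡⟨ sumTo-single (suc (v + j)) v (s≤s (m≤m+n v j)) (λ b _ b≢v → monomial-off-* u b (b≢v ∘ proj₂) _) ⟩
  monomial u v u v *ℤ f (u + i ∸ u) (v + j ∸ v)
    ≡⟨ cong₂ (λ c k → c *ℤ f k (v + j ∸ v)) (monomial-diag u v) (m+n∸m≡n u i) ⟩
  + 1 *ℤ f i (v + j ∸ v)
    ≡⟨ trans (ℤ.*-identityˡ _) (cong (f i) (m+n∸m≡n v j)) ⟩
  f i j ∎
  where
  open ≡-Reasoning

monomial⊛-below : ∀ u v f i j → i < u ⊎ j < v → (monomial u v ⊛ f) i j ≡ + 0
monomial⊛-below u v f i j below =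
  sumTo-zero (suc i) λ a a<1+i → sumTo-zero (suc j) λ b b<1+j →
    monomial-off-* a b (λ (a≡u , b≡v) → off below a≡u b≡v (≤-pred a<1+i) (≤-pred b<1+j)) _
  where
  off : ∀ {a b} → i < u ⊎ j < v → a ≡ u → b ≡ v → a ≤ i → b ≤ j → ⊥
  off (inj₁ i<a) refl refl a≤i b≤j = <-irrefl refl (≤-<-trans a≤i i<a)
  off (inj₂ j<b) refl refl a≤i b≤j = <-irrefl refl (≤-<-trans b≤j j<b)

⊛-identityˡ : ∀ f → 1S ⊛ f ≐ f
⊛-identityˡ f = monomial⊛-shift 0 0 f

pow-X : ∀ n → pow X n ≐ monomial n 0
pow-X zero    i j = refl
pow-X (suc n) i j = trans (⊛-congʳ X (pow-X n) i j) (step i j)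
  where
  step : ∀ i j → (X ⊛ monomial n 0) i j ≡ monomial (suc n) 0 i j
  step zero    j = monomial⊛-below 1 0 (monomial n 0) 0 j (inj₁ (s≤s z≤n))
  step (suc i) j = monomial⊛-shift 1 0 (monomial n 0) i j

pow-Y : ∀ n → pow Y n ≐ monomial 0 n
pow-Y zero    i j = refl
pow-Y (suc n) i j = trans (⊛-congʳ Y (pow-Y n) i j) (step i j)
  where
  step : ∀ i j → (Y ⊛ monomial 0 n) i j ≡ monomial 0 (suc n) i j
  step i zero    = trans (monomial⊛-below 0 1 (monomial 0 n) i 0 (inj₂ (s≤s z≤n))) (sym (monomial-off {0} {suc n} i 0 λ ()))
  step i (suc j) = monomial⊛-shift 0 1 (monomial 0 n) i j

[x+y]^ : ℕ → Ser
[x+y]^ n = pow (X ⊕ Y) n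

[x+y]^-suc : ∀ n i j → [x+y]^ (suc n) i j ≡ (X ⊛ [x+y]^ n) i j +ℤ (Y ⊛ [x+y]^ n) i j
[x+y]^-suc n = ⊛-distribʳ X Y ([x+y]^ n)

[x+y]^-off : ∀ n i j → i + j ≢ n → [x+y]^ n i j ≡ + 0
[x+y]^-off zero    i j i+j≢0 = monomial-off i j λ { (refl , refl) → i+j≢0 refl }
[x+y]^-off (suc n) i j i+j≢1+n = trans ([x+y]^-suc n i j) (cong₂ _+ℤ_ (X-part i j i+j≢1+n) (Y-part i j i+j≢1+n))
  where
  X-part : ∀ i j → i + j ≢ suc n → (X ⊛ [x+y]^ n) i j ≡ + 0
  X-part zero    j _       = monomial⊛-below 1 0 ([x+y]^ n) 0 j (inj₁ (s≤s z≤n))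
  X-part (suc i) j i+j≢1+n = trans (monomial⊛-shift 1 0 ([x+y]^ n) i j) ([x+y]^-off n i j (i+j≢1+n ∘ cong suc))
  Y-part : ∀ i j → i + j ≢ suc n → (Y ⊛ [x+y]^ n) i j ≡ + 0
  Y-part i zero    _       = monomial⊛-below 0 1 ([x+y]^ n) i 0 (inj₂ (s≤s z≤n))
  Y-part i (suc j) i+j≢1+n =
    trans (monomial⊛-shift 0 1 ([x+y]^ n) i j) ([x+y]^-off n i j (i+j≢1+n ∘ trans (+-suc i j) ∘ cong suc))

[x+y]^-diag : ∀ i j → [x+y]^ (i + j) i j ≡ + ((i + j) C i)
[x+y]^-diag zero    zero    = refl
[x+y]^-diag zero    (suc j) = begin
  [x+y]^ (suc j) 0 (suc j)
    ≡⟨ [x+y]^-suc j 0 (suc j) ⟩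
  (X ⊛ [x+y]^ j) 0 (suc j) +ℤ (Y ⊛ [x+y]^ j) 0 (suc j)
    ≡⟨ cong₂ _+ℤ_ (monomial⊛-below 1 0 ([x+y]^ j) 0 (suc j) (inj₁ (s≤s z≤n))) (monomial⊛-shift 0 1 ([x+y]^ j) 0 j) ⟩
  + 0 +ℤ [x+y]^ j 0 j
    ≡⟨ ℤ.+-identityˡ _ ⟩
  [x+y]^ (0 + j) 0 j
    ≡⟨ [x+y]^-diag 0 j ⟩
  + 1 ∎
  where open ≡-Reasoning
[x+y]^-diag (suc i) j = begin
  [x+y]^ (suc (i + j)) (suc i) j
    ≡⟨ [x+y]^-suc (i + j) (suc i) j ⟩
  (X ⊛ [x+y]^ (i + j)) (suc i) j +ℤ (Y ⊛ [x+y]^ (i + j)) (suc i) j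
    ≡⟨ cong₂ _+ℤ_ (trans (monomial⊛-shift 1 0 ([x+y]^ (i + j)) i j) ([x+y]^-diag i j)) (Y-part j) ⟩
  + ((i + j) C i) +ℤ + ((i + j) C suc i)
    ≡⟨ cong +_ (nCk+nC[k+1]≡[n+1]C[k+1] (i + j) i) ⟩
  + (suc (i + j) C suc i) ∎
  where
  open ≡-Reasoning
  Y-part : ∀ j → (Y ⊛ [x+y]^ (i + j)) (suc i) j ≡ + ((i + j) C suc i)
  Y-part zero    = trans (monomial⊛-below 0 1 ([x+y]^ (i + 0)) (suc i) 0 (inj₂ (s≤s z≤n)))
                         (cong +_ (sym (k>n⇒nCk≡0 (s≤s (≤-reflexive (+-identityʳ i))))))
  Y-part (suc j) = begin
    (Y ⊛ [x+y]^ (i + suc j)) (suc i) (suc j)   ≡⟨ monomial⊛-shift 0 1 ([x+y]^ (i + suc j)) (suc i) j ⟩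
    [x+y]^ (i + suc j) (suc i) j               ≡⟨ cong (λ n → [x+y]^ n (suc i) j) (+-suc i j) ⟩
    [x+y]^ (suc i + j) (suc i) j               ≡⟨ [x+y]^-diag (suc i) j ⟩
    + ((suc i + j) C suc i)                    ≡⟨ cong (λ n → + (n C suc i)) (+-suc i j) ⟨
    + ((i + suc j) C suc i)                    ∎

-- Only b = m contributes, as (x+y)^m has no other monomial x^0 y^b.
[x+y]^⊛-column₀ : ∀ m q j → ([x+y]^ m ⊛ q) 0 (m + j) ≡ q 0 j
[x+y]^⊛-column₀ m q j = begin
  + 0 +ℤ sumTo (suc (m + j)) (λ b → [x+y]^ m 0 b *ℤ q 0 (m + j ∸ b))
    ≡⟨ ℤ.+-identityˡ _ ⟩
  sumTo (suc (m + j)) (λ b → [x+y]^ m 0 b *ℤ q 0 (m + j ∸ b))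
    ≡⟨ sumTo-single (suc (m + j)) m (s≤s (m≤m+n m j)) (λ b _ b≢m →
         trans (cong (_*ℤ q 0 (m + j ∸ b)) ([x+y]^-off m 0 b b≢m)) (ℤ.*-zeroˡ (q 0 (m + j ∸ b)))) ⟩
  [x+y]^ m 0 m *ℤ q 0 (m + j ∸ m)
    ≡⟨ cong₂ _*ℤ_ ([x+y]^-diag 0 m) (cong (q 0) (m+n∸m≡n m j)) ⟩
  + 1 *ℤ q 0 j
    ≡⟨ ℤ.*-identityˡ (q 0 j) ⟩
  q 0 j ∎
  where open ≡-Reasoning

-- The ring S = F_p[x,y]

module _ (p : ℕ) where

  record _~_ (a b : ℤ) : Set where
    constructor mk~
    field p∣a-b : + p Signed.∣ a - b
  open _~_

  infix 4 _~_

  p∣-resp : ∀ {a b} → a ≡ b → + p Signed.∣ a → + p Signed.∣ b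
  p∣-resp = subst (+ p Signed.∣_)

  ≡⇒~ : ∀ {a b} → a ≡ b → a ~ b
  ≡⇒~ {a} refl = mk~ (Signed.divides (+ 0) (ℤ.+-inverseʳ a))

  ~-sym : ∀ {a b} → a ~ b → b ~ a
  ~-sym {a} {b} (mk~ p∣) = mk~ (p∣-resp (neg-diff a b) (Signed.∣m⇒∣-m p∣))
    where
    neg-diff : ∀ a b → - (a - b) ≡ b - a
    neg-diff = ℤ-Solver.solve-∀

  ~-trans : ∀ {a b c} → a ~ b → b ~ c → a ~ c
  ~-trans {a} {b} {c} (mk~ p∣) (mk~ p∣′) = mk~ (p∣-resp (ℤ.+-minus-telescope a b c) (Signed.∣m∣n⇒∣m+n p∣ p∣′))

  ~-+ : ∀ {a a′ b b′} → a ~ a′ → b ~ b′ → a +ℤ b ~ a′ +ℤ b′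
  ~-+ {a} {a′} {b} {b′} (mk~ p∣) (mk~ p∣′) = mk~ (p∣-resp (diff-+ a a′ b b′) (Signed.∣m∣n⇒∣m+n p∣ p∣′))
    where
    diff-+ : ∀ a a′ b b′ → (a - a′) +ℤ (b - b′) ≡ (a +ℤ b) - (a′ +ℤ b′)
    diff-+ = ℤ-Solver.solve-∀

  ~-neg : ∀ {a a′} → a ~ a′ → - a ~ - a′
  ~-neg {a} {a′} (mk~ p∣) = mk~ (p∣-resp (diff-neg a a′) (Signed.∣m⇒∣-m p∣))
    where
    diff-neg : ∀ a a′ → - (a - a′) ≡ - a - - a′
    diff-neg = ℤ-Solver.solve-∀

  ~-* : ∀ {a a′ b b′} → a ~ a′ → b ~ b′ → a *ℤ b ~ a′ *ℤ b′
  ~-* {a} {a′} {b} {b′} (mk~ p∣) (mk~ p∣′) =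
    mk~ (p∣-resp (diff-* a a′ b b′) (Signed.∣m∣n⇒∣m+n (Signed.∣m⇒∣m*n b p∣) (Signed.∣n⇒∣m*n a′ p∣′)))
    where
    diff-* : ∀ a a′ b b′ → (a - a′) *ℤ b +ℤ a′ *ℤ (b - b′) ≡ a *ℤ b - a′ *ℤ b′
    diff-* = ℤ-Solver.solve-∀

  sumTo-~ : ∀ n {f g : ℕ → ℤ} → (∀ a → a < n → f a ~ g a) → sumTo n f ~ sumTo n g
  sumTo-~ zero    f~g = ≡⇒~ refl
  sumTo-~ (suc n) f~g = ~-+ (sumTo-~ n (λ a a<n → f~g a (m≤n⇒m≤1+n a<n))) (f~g n ≤-refl)

  record _≈_ (f g : Ser) : Set where
    constructor mk≈
    field coeff : ∀ i j → f i j ~ g i j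
  open _≈_

  infix 4 _≈_

  ≐⇒≈ : ∀ {f g} → f ≐ g → f ≈ g
  ≐⇒≈ f≐g = mk≈ λ i j → ≡⇒~ (f≐g i j)

  ≈⇒≈[p] : ∀ {f g} → f ≈ g → f ≈[ p ] g
  ≈⇒≈[p] f≈g i j = ∣⇒∣ᵤ (p∣a-b (coeff f≈g i j))

  ≈[p]⇒≈ : ∀ {f g} → f ≈[ p ] g → f ≈ g
  ≈[p]⇒≈ f≈g = mk≈ λ i j → mk~ (∣ᵤ⇒∣ (f≈g i j))

  SerRing : CommutativeRing _ _
  SerRing = record
    { Carrier = Ser ; _≈_ = _≈_ ; _+_ = _⊕_ ; _*_ = _⊛_ ; -_ = ⊖_ ; 0# = 0S ; 1# = 1S
    ; isCommutativeRing = record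
      { isRing = record
        { +-isAbelianGroup = record
          { isGroup = record
            { isMonoid = record
              { isSemigroup = record
                { isMagma = record
                  { isEquivalence = record
                    { refl  = ≐⇒≈ (λ _ _ → refl)
                    ; sym   = λ (mk≈ f~g) → mk≈ λ i j → ~-sym (f~g i j)
                    ; trans = λ (mk≈ f~g) (mk≈ g~h) → mk≈ λ i j → ~-trans (f~g i j) (g~h i j) }
                  ; ∙-cong = λ (mk≈ f~f′) (mk≈ g~g′) → mk≈ λ i j → ~-+ (f~f′ i j) (g~g′ i j) }
                ; assoc = λ f g h → ≐⇒≈ λ i j → ℤ.+-assoc (f i j) (g i j) (h i j) }
              ; identity = (λ f → ≐⇒≈ λ i j → ℤ.+-identityˡ (f i j)) , (λ f → ≐⇒≈ λ i j → ℤ.+-identityʳ (f i j)) }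
            ; inverse = (λ f → ≐⇒≈ λ i j → ℤ.+-inverseˡ (f i j)) , (λ f → ≐⇒≈ λ i j → ℤ.+-inverseʳ (f i j))
            ; ⁻¹-cong = λ (mk≈ f~f′) → mk≈ λ i j → ~-neg (f~f′ i j) }
          ; comm = λ f g → ≐⇒≈ λ i j → ℤ.+-comm (f i j) (g i j) }
        ; *-cong = λ (mk≈ f~f′) (mk≈ g~g′) → mk≈ λ i j →
            sumTo-~ (suc i) λ a _ → sumTo-~ (suc j) λ b _ → ~-* (f~f′ a b) (g~g′ (i ∸ a) (j ∸ b))
        ; *-assoc = λ f g h → ≐⇒≈ (⊛-assoc f g h)
        ; *-identity = (λ f → ≐⇒≈ (⊛-identityˡ f)) , (λ f → ≐⇒≈ λ i j → trans (⊛-comm f 1S i j) (⊛-identityˡ f i j))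
        ; distrib = (λ h f g → ≐⇒≈ λ i j → trans (⊛-comm h (f ⊕ g) i j)
                                 (trans (⊛-distribʳ f g h i j) (cong₂ _+ℤ_ (⊛-comm f h i j) (⊛-comm g h i j))))
                  , (λ h f g → ≐⇒≈ (⊛-distribʳ f g h)) }
      ; *-comm = λ f g → ≐⇒≈ (⊛-comm f g) } }

  scalar : ℤ → Ser
  scalar c i j = c *ℤ 1S i j

  scalar⊛ : ∀ c f → scalar c ⊛ f ≐ λ i j → c *ℤ f i j
  scalar⊛ c f i j = begin
    sumTo (suc i) (λ a → sumTo (suc j) (λ b → c *ℤ 1S a b *ℤ f (i ∸ a) (j ∸ b)))
      ≡⟨ sumTo-cong (suc i) (λ a _ → trans (sumTo-cong (suc j) λ b _ → ℤ.*-assoc c (1S a b) _) (sym (sumTo-*ˡ (suc j) c _))) ⟩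
    sumTo (suc i) (λ a → c *ℤ sumTo (suc j) (λ b → 1S a b *ℤ f (i ∸ a) (j ∸ b)))
      ≡⟨ sumTo-*ˡ (suc i) c _ ⟨
    c *ℤ (1S ⊛ f) i j
      ≡⟨ cong (c *ℤ_) (⊛-identityˡ f i j) ⟩
    c *ℤ f i j ∎
    where open ≡-Reasoning

  scalar-homomorphism : +-*-rawRing -Raw-AlmostCommutative⟶ fromCommutativeRing SerRing
  scalar-homomorphism = record
    { ⟦_⟧    = scalar
    ; +-homo = λ c d → ≐⇒≈ λ i j → ℤ.*-distribʳ-+ (1S i j) c d
    ; *-homo = λ c d → ≐⇒≈ λ i j → trans (ℤ.*-assoc c d (1S i j)) (sym (scalar⊛ c (scalar d) i j))
    ; -‿homo = λ c → ≐⇒≈ λ i j → sym (ℤ.neg-distribˡ-* c (1S i j))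
    ; 0-homo = ≐⇒≈ λ i j → ℤ.*-zeroˡ (1S i j)
    ; 1-homo = ≐⇒≈ λ i j → ℤ.*-identityˡ (1S i j)
    }

  scalar-≟ : ∀ c d → Maybe (scalar c ≈ scalar d)
  scalar-≟ c d with c ℤ.≟ d
  ... | yes refl = just (≐⇒≈ λ _ _ → refl)
  ... | no _     = nothing

  open import Algebra.Solver.Ring (+-*-rawRing) (fromCommutativeRing SerRing) scalar-homomorphism scalar-≟

  module ≈-Reasoning = SetoidReasoning (CommutativeRing.setoid SerRing)

  open CommutativeRing SerRing
    using () renaming (refl to ≈-refl; sym to ≈-sym; trans to ≈-trans; +-cong to ⊕-cong; *-cong to ⊛-cong; -‿cong to ⊖-cong;
              zeroˡ to ⊛-zeroˡ; zeroʳ to ⊛-zeroʳ; +-identityʳ to ⊕-identityʳ)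

  p∣⇒~0 : ∀ {a} → + p ∣ᵤ a → a ~ + 0
  p∣⇒~0 {a} p∣a = mk~ (subst (+ p Signed.∣_) (sym (ℤ.+-identityʳ a)) (∣ᵤ⇒∣ p∣a))

  ~0⇒p∣ : ∀ {a} → a ~ + 0 → + p ∣ᵤ a
  ~0⇒p∣ {a} (mk~ p∣a-0) = ∣⇒∣ᵤ (subst (+ p Signed.∣_) (ℤ.+-identityʳ a) p∣a-0)

  ~0-*ˡ : ∀ {a} b → a ~ + 0 → a *ℤ b ~ + 0
  ~0-*ˡ b a~0 = ~-trans (~-* a~0 (≡⇒~ {b} refl)) (≡⇒~ (ℤ.*-zeroˡ b))

  ~0-*ʳ : ∀ a {b} → b ~ + 0 → a *ℤ b ~ + 0
  ~0-*ʳ a b~0 = ~-trans (~-* (≡⇒~ {a} refl) b~0) (≡⇒~ (ℤ.*-zeroʳ a))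

  sumTo-~0 : ∀ n {f : ℕ → ℤ} → (∀ a → a < n → f a ~ + 0) → sumTo n f ~ + 0
  sumTo-~0 n f~0 = ~-trans (sumTo-~ n f~0) (≡⇒~ (sumTo-zero n λ _ _ → refl))

  mkPoly : ∀ {f} N → (∀ i j → N ≤ i + j → f i j ~ + 0) → IsPoly p f
  mkPoly N f~0 = N , λ i j N≤i+j → ~0⇒p∣ (f~0 i j N≤i+j)

  poly-~0 : ∀ f ((N , _) : IsPoly p f) → ∀ i j → N ≤ i + j → f i j ~ + 0
  poly-~0 f (N , p∣f) i j N≤i+j = p∣⇒~0 (p∣f i j N≤i+j)

  IsPoly-resp : ∀ {f g} → f ≈ g → IsPoly p f → IsPoly p g
  IsPoly-resp {f} f≈g f-poly@(N , _) = mkPoly N λ i j N≤i+j → ~-trans (~-sym (coeff f≈g i j)) (poly-~0 f f-poly i j N≤i+j)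

  IsPoly-0S : IsPoly p 0S
  IsPoly-0S = mkPoly 0 λ _ _ _ → ≡⇒~ refl

  IsPoly-⊕ : ∀ {f g} → IsPoly p f → IsPoly p g → IsPoly p (f ⊕ g)
  IsPoly-⊕ {f} {g} f-poly@(N , _) g-poly@(M , _) = mkPoly (N + M) λ i j N+M≤i+j →
    ~-+ (poly-~0 f f-poly i j (≤-trans (m≤m+n N M) N+M≤i+j)) (poly-~0 g g-poly i j (≤-trans (m≤n+m M N) N+M≤i+j))

  IsPoly-⊖ : ∀ {f} → IsPoly p f → IsPoly p (⊖ f)
  IsPoly-⊖ {f} f-poly@(N , _) = mkPoly N λ i j N≤i+j → ~-neg (poly-~0 f f-poly i j N≤i+j)

  IsPoly-⊛ : ∀ {f g} → IsPoly p f → IsPoly p g → IsPoly p (f ⊛ g)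
  IsPoly-⊛ {f} {g} f-poly@(N , _) g-poly@(M , _) = mkPoly (N + M) λ i j N+M≤i+j →
    sumTo-~0 (suc i) λ a a<1+i → sumTo-~0 (suc j) λ b b<1+j → term N+M≤i+j (≤-pred a<1+i) (≤-pred b<1+j)
    where
    term : ∀ {i j a b} → N + M ≤ i + j → a ≤ i → b ≤ j → f a b *ℤ g (i ∸ a) (j ∸ b) ~ + 0
    term {i} {j} {a} {b} N+M≤i+j a≤i b≤j with N ≤? a + b
    ... | yes N≤a+b = ~0-*ˡ (g (i ∸ a) (j ∸ b)) (poly-~0 f f-poly a b N≤a+b)
    ... | no  N≰a+b = ~0-*ʳ (f a b) (poly-~0 g g-poly (i ∸ a) (j ∸ b) (+-cancelˡ-≤ (a + b) M (i ∸ a + (j ∸ b)) (begin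
          a + b + M                         ≤⟨ +-monoˡ-≤ M (<⇒≤ (≰⇒> N≰a+b)) ⟩
          N + M                             ≤⟨ N+M≤i+j ⟩
          i + j                             ≡⟨ [a+b]+[i∸a+j∸b]≡i+j a≤i b≤j ⟨
          a + b + (i ∸ a + (j ∸ b))         ∎)))
      where open ≤-Reasoning

  IsPoly-monomial : ∀ u v → IsPoly p (monomial u v)
  IsPoly-monomial u v = mkPoly (suc (u + v)) λ i j 1+u+v≤i+j →
    ≡⇒~ (monomial-off i j λ { (refl , refl) → <-irrefl refl 1+u+v≤i+j })

  IsPoly-pow : ∀ {f} n → IsPoly p f → IsPoly p (pow f n)
  IsPoly-pow zero    _      = IsPoly-monomial 0 0
  IsPoly-pow {f} (suc n) f-poly = IsPoly-⊛ {f} {pow f n} f-poly (IsPoly-pow n f-poly)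

  DivS-resp : ∀ {a f g} → f ≈ g → DivS p a f → DivS p a g
  DivS-resp {a} {f} f≈g (q , q-poly , f≈aq) = q , q-poly , ≈⇒≈[p] (≈-trans (≈-sym f≈g) (≈[p]⇒≈ {f} {a ⊛ q} f≈aq))

  monomial⊛-injective : ∀ u v {f g} → monomial u v ⊛ f ≈ monomial u v ⊛ g → f ≈ g
  monomial⊛-injective u v {f} {g} uvf≈uvg = mk≈ λ i j →
    subst₂ _~_ (monomial⊛-shift u v f i j) (monomial⊛-shift u v g i j) (coeff uvf≈uvg (u + i) (v + j))

  powX⊛-injective : ∀ n {f g} → pow X n ⊛ f ≈ pow X n ⊛ g → f ≈ g
  powX⊛-injective n {f} {g} xf≈xg = monomial⊛-injective n 0
    (≈-trans (≐⇒≈ (⊛-congˡ f (λ i j → sym (pow-X n i j)))) (≈-trans xf≈xg (≐⇒≈ (⊛-congˡ g (pow-X n)))))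

  powY⊛-injective : ∀ n {f g} → pow Y n ⊛ f ≈ pow Y n ⊛ g → f ≈ g
  powY⊛-injective n {f} {g} yf≈yg = monomial⊛-injective 0 n
    (≈-trans (≐⇒≈ (⊛-congˡ f (λ i j → sym (pow-Y n i j)))) (≈-trans yf≈yg (≐⇒≈ (⊛-congˡ g (pow-Y n)))))

  -- If x h = (x+y)^m q, comparing the coefficients of x^0 y^(m+j) shows that x divides q.
  [x+y]^∣X⊛⇒∣ : ∀ m {h} → DivS p ([x+y]^ m) (X ⊛ h) → DivS p ([x+y]^ m) h
  [x+y]^∣X⊛⇒∣ m {h} (q , q-poly@(N , _) , xh≈eq) = r , r-poly , ≈⇒≈[p] h≈er
    where
    r : Ser
    r i j = q (suc i) j
    r-poly : IsPoly p r
    r-poly = mkPoly N λ i j N≤i+j → poly-~0 q q-poly (suc i) j (m≤n⇒m≤1+n N≤i+j)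
    xh≈eq′ : X ⊛ h ≈ [x+y]^ m ⊛ q
    xh≈eq′ = ≈[p]⇒≈ {X ⊛ h} {[x+y]^ m ⊛ q} xh≈eq
    q≈xr : q ≈ X ⊛ r
    q≈xr = mk≈ λ where
      zero    j → ~-trans (≡⇒~ (sym ([x+y]^⊛-column₀ m q j)))
                    (~-trans (~-sym (coeff xh≈eq′ 0 (m + j)))
                      (≡⇒~ (trans (monomial⊛-below 1 0 h 0 (m + j) (inj₁ (s≤s z≤n)))
                                  (sym (monomial⊛-below 1 0 r 0 j (inj₁ (s≤s z≤n)))))))
      (suc i) j → ≡⇒~ (sym (monomial⊛-shift 1 0 r i j))
    h≈er : h ≈ [x+y]^ m ⊛ r
    h≈er = monomial⊛-injective 1 0 (begin
      X ⊛ h                   ≈⟨ xh≈eq′ ⟩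
      [x+y]^ m ⊛ q            ≈⟨ ⊛-cong (≈-refl {[x+y]^ m}) q≈xr ⟩
      [x+y]^ m ⊛ (X ⊛ r)      ≈⟨ solve 3 (λ e x r → e :* (x :* r) := x :* (e :* r)) ≈-refl ([x+y]^ m) X r ⟩
      X ⊛ ([x+y]^ m ⊛ r)      ∎)
      where open ≈-Reasoning

  [x+y]^∣powX⊛⇒∣ : ∀ m a {h} → DivS p ([x+y]^ m) (pow X a ⊛ h) → DivS p ([x+y]^ m) h
  [x+y]^∣powX⊛⇒∣ m zero    {h} e∣h = DivS-resp {[x+y]^ m} (≐⇒≈ (⊛-identityˡ h)) e∣h
  [x+y]^∣powX⊛⇒∣ m (suc a) {h} e∣xᵃ⁺¹h = [x+y]^∣X⊛⇒∣ m {h} ([x+y]^∣powX⊛⇒∣ m a {X ⊛ h} (DivS-resp {[x+y]^ m}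
    (solve 3 (λ x xᵃ h → (x :* xᵃ) :* h := xᵃ :* (x :* h)) ≈-refl X (pow X a) h) e∣xᵃ⁺¹h))

  [x+y]^≈ : ∀ n → n ≢ 0 → (∀ k → 0 < k → k < n → p ∣ n C k) → [x+y]^ n ≈ pow X n ⊕ pow Y n
  [x+y]^≈ n n≢0 p∣nCk = mk≈ λ i j → ~-trans (coefficient i j) (≡⇒~ (sym (cong₂ _+ℤ_ (pow-X n i j) (pow-Y n i j))))
    where
    coefficient : ∀ i j → [x+y]^ n i j ~ monomial n 0 i j +ℤ monomial 0 n i j
    coefficient i j with i + j ≟ n
    ... | no i+j≢n = ≡⇒~ (trans ([x+y]^-off n i j i+j≢n) (sym (cong₂ _+ℤ_
            (monomial-off i j λ { (refl , refl) → i+j≢n (+-identityʳ n) })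
            (monomial-off i j λ { (refl , refl) → i+j≢n refl }))))
    ... | yes refl = ~-trans (≡⇒~ ([x+y]^-diag i j)) (diagonal i j n≢0 p∣nCk)
      where
      diagonal : ∀ i j → i + j ≢ 0 → (∀ k → 0 < k → k < i + j → p ∣ (i + j) C k) →
                 + ((i + j) C i) ~ monomial (i + j) 0 i j +ℤ monomial 0 (i + j) i j
      diagonal zero    zero    0≢0 _      = ⊥-elim (0≢0 refl)
      diagonal zero    (suc j) _   _      = ≡⇒~ (sym (cong (+ 0 +ℤ_) (monomial-diag 0 (suc j))))
      diagonal (suc i) zero    _   _      = ≡⇒~ (begin
        + ((suc i + 0) C suc i)                            ≡⟨ cong (λ n → + (n C suc i)) (+-identityʳ (suc i)) ⟩
        + (suc i C suc i)                                  ≡⟨ cong +_ (nCn≡1 (suc i)) ⟩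
        + 1                                                ≡⟨ monomial-at {suc i + 0} {0} (sym (+-identityʳ (suc i))) refl ⟨
        monomial (suc i + 0) 0 (suc i) 0                   ≡⟨ ℤ.+-identityʳ _ ⟨
        monomial (suc i + 0) 0 (suc i) 0 +ℤ + 0            ∎)
        where open ≡-Reasoning
      diagonal (suc i) (suc j) _   p∣nCk =
        ~-trans (p∣⇒~0 {+ ((suc i + suc j) C suc i)} (p∣nCk (suc i) (s≤s z≤n) (m<m+n (suc i) (s≤s z≤n))))
                (≡⇒~ (sym (cong₂ _+ℤ_ (monomial-off {suc i + suc j} {0} (suc i) (suc j) λ ())
                                      (monomial-off {0} {suc i + suc j} (suc i) (suc j) λ ()))))

  pow-+ : ∀ f a b → pow f a ⊛ pow f b ≈ pow f (a + b)
  pow-+ f zero    b = ≐⇒≈ (⊛-identityˡ (pow f b))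
  pow-+ f (suc a) b = ≈-trans (≐⇒≈ (⊛-assoc f (pow f a) (pow f b))) (⊛-cong (≈-refl {f}) (pow-+ f a b))

  pow-+-∸ : ∀ f {a n} → a ≤ n → pow f a ⊛ pow f (n ∸ a) ≈ pow f n
  pow-+-∸ f {a} {n} a≤n = subst (λ k → pow f a ⊛ pow f (n ∸ a) ≈ pow f k) (m+[n∸m]≡n a≤n) (pow-+ f a (n ∸ a))

  -- Derivations and bases of D(A, μ)

  infix 4 _≈ᴰ_

  record _≈ᴰ_ (θ η : Der) : Set where
    constructor _,_
    field
      ∂x : proj₁ θ ≈ proj₁ η
      ∂y : proj₂ θ ≈ proj₂ η

  ≈ᴰ-refl : ∀ {θ} → θ ≈ᴰ θ
  ≈ᴰ-refl = ≈-refl , ≈-refl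

  ≈ᴰ-sym : ∀ {θ η} → θ ≈ᴰ η → η ≈ᴰ θ
  ≈ᴰ-sym (P≈ , Q≈) = ≈-sym P≈ , ≈-sym Q≈

  ≈ᴰ-trans : ∀ {θ η ζ} → θ ≈ᴰ η → η ≈ᴰ ζ → θ ≈ᴰ ζ
  ≈ᴰ-trans (P≈ , Q≈) (P≈′ , Q≈′) = ≈-trans P≈ P≈′ , ≈-trans Q≈ Q≈′

  ≈ᴰ⇒≈D : ∀ {θ η} → θ ≈ᴰ η → θ ≈D[ p ] η
  ≈ᴰ⇒≈D (P≈ , Q≈) = ≈⇒≈[p] P≈ , ≈⇒≈[p] Q≈

  ≈D⇒≈ᴰ : ∀ θ η → θ ≈D[ p ] η → θ ≈ᴰ η
  ≈D⇒≈ᴰ (P , Q) (P′ , Q′) (P≈ , Q≈) = ≈[p]⇒≈ {P} {P′} P≈ , ≈[p]⇒≈ {Q} {Q′} Q≈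

  ⊖ᴰ : Der → Der
  ⊖ᴰ (P , Q) = ⊖ P , ⊖ Q

  combination-cong : ∀ {a a′ b b′ θ θ′ η η′} → a ≈ a′ → b ≈ b′ → θ ≈ᴰ θ′ → η ≈ᴰ η′ →
    (a ·D θ) +D (b ·D η) ≈ᴰ (a′ ·D θ′) +D (b′ ·D η′)
  combination-cong {θ = _ , _} {_ , _} {_ , _} {_ , _} a≈ b≈ (P≈ , Q≈) (P≈′ , Q≈′) =
    ⊕-cong (⊛-cong a≈ P≈) (⊛-cong b≈ P≈′) , ⊕-cong (⊛-cong a≈ Q≈) (⊛-cong b≈ Q≈′)

  combination-swap : ∀ a b θ η → (a ·D θ) +D (b ·D η) ≈ᴰ (b ·D η) +D (a ·D θ)
  combination-swap a b (P , Q) (P′ , Q′) =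
    ≐⇒≈ (λ i j → ℤ.+-comm ((a ⊛ P) i j) ((b ⊛ P′) i j)) , ≐⇒≈ (λ i j → ℤ.+-comm ((a ⊛ Q) i j) ((b ⊛ Q′) i j))

  combination-⊖ : ∀ a b θ η → (a ·D ⊖ᴰ θ) +D (b ·D ⊖ᴰ η) ≈ᴰ ((⊖ a) ·D θ) +D ((⊖ b) ·D η)
  combination-⊖ a b (P , Q) (P′ , Q′) = lemma P P′ , lemma Q Q′
    where
    lemma : ∀ P P′ → a ⊛ ⊖ P ⊕ b ⊛ ⊖ P′ ≈ ⊖ a ⊛ P ⊕ ⊖ b ⊛ P′
    lemma P P′ = solve 4 (λ a b P P′ → a :* (:- P) :+ b :* (:- P′) := (:- a) :* P :+ (:- b) :* P′) ≈-refl a b P P′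

  DivS-⊖ : ∀ {a f} → DivS p a f → DivS p a (⊖ f)
  DivS-⊖ {a} {f} (q , q-poly , f≈aq) = ⊖ q , IsPoly-⊖ {q} q-poly ,
    ≈⇒≈[p] (≈-trans (⊖-cong (≈[p]⇒≈ {f} {a ⊛ q} f≈aq)) (solve 2 (λ a q → :- (a :* q) := a :* (:- q)) ≈-refl a q))

  InD-resp : ∀ μ {θ η} → θ ≈ᴰ η → InD p μ θ → InD p μ η
  InD-resp (μ₁ , μ₂ , μ₃) {P , Q} {P′ , Q′} (P≈ , Q≈) ((P-poly , Q-poly) , xᵘ∣P , yᵛ∣Q , eʷ∣P+Q) =
    (IsPoly-resp {P} P≈ P-poly , IsPoly-resp {Q} Q≈ Q-poly) ,
    DivS-resp {pow X μ₁} P≈ xᵘ∣P , DivS-resp {pow Y μ₂} Q≈ yᵛ∣Q , DivS-resp {[x+y]^ μ₃} (⊕-cong P≈ Q≈) eʷ∣P+Q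

  InD-⊖ : ∀ μ {θ} → InD p μ θ → InD p μ (⊖ᴰ θ)
  InD-⊖ (μ₁ , μ₂ , μ₃) {P , Q} ((P-poly , Q-poly) , xᵘ∣P , yᵛ∣Q , eʷ∣P+Q) =
    (IsPoly-⊖ {P} P-poly , IsPoly-⊖ {Q} Q-poly) , DivS-⊖ {pow X μ₁} {P} xᵘ∣P , DivS-⊖ {pow Y μ₂} {Q} yᵛ∣Q ,
    DivS-resp {[x+y]^ μ₃} (solve 2 (λ P Q → :- (P :+ Q) := :- P :+ :- Q) ≈-refl P Q) (DivS-⊖ {[x+y]^ μ₃} {P ⊕ Q} eʷ∣P+Q)

  IsBasis-resp : ∀ μ {θ θ′ η η′} → θ ≈ᴰ θ′ → η ≈ᴰ η′ → IsBasis p μ θ η → IsBasis p μ θ′ η′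
  IsBasis-resp μ {θ} {θ′} {η} {η′} θ≈ η≈ (θ∈D , η∈D , spans , independent) =
    InD-resp μ θ≈ θ∈D , InD-resp μ η≈ η∈D ,
    (λ ζ ζ∈D → let a , b , a-poly , b-poly , ζ≈ = spans ζ ζ∈D in
      a , b , a-poly , b-poly ,
      ≈ᴰ⇒≈D (≈ᴰ-trans (≈D⇒≈ᴰ ζ _ ζ≈) (combination-cong {a} {a} {b} {b} ≈-refl ≈-refl θ≈ η≈))) ,
    (λ a b a-poly b-poly aθ′+bη′≈0 → independent a b a-poly b-poly
      (≈ᴰ⇒≈D (≈ᴰ-trans (combination-cong {a} {a} {b} {b} ≈-refl ≈-refl θ≈ η≈) (≈D⇒≈ᴰ _ 0D aθ′+bη′≈0))))

  IsBasis-swap : ∀ μ {θ η} → IsBasis p μ θ η → IsBasis p μ η θ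
  IsBasis-swap μ {θ} {η} (θ∈D , η∈D , spans , independent) =
    η∈D , θ∈D ,
    (λ ζ ζ∈D → let a , b , a-poly , b-poly , ζ≈ = spans ζ ζ∈D in
      b , a , b-poly , a-poly , ≈ᴰ⇒≈D (≈ᴰ-trans (≈D⇒≈ᴰ ζ _ ζ≈) (combination-swap a b θ η))) ,
    (λ a b a-poly b-poly aη+bθ≈0 → swap (independent b a b-poly a-poly
      (≈ᴰ⇒≈D (≈ᴰ-trans (combination-swap b a θ η) (≈D⇒≈ᴰ _ 0D aη+bθ≈0)))))

  IsBasis-⊖ : ∀ μ {θ η} → IsBasis p μ θ η → IsBasis p μ (⊖ᴰ θ) (⊖ᴰ η)
  IsBasis-⊖ μ {θ} {η} (θ∈D , η∈D , spans , independent) =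
    InD-⊖ μ {θ} θ∈D , InD-⊖ μ {η} η∈D ,
    (λ ζ ζ∈D → let a , b , a-poly , b-poly , ζ≈ = spans ζ ζ∈D in
      ⊖ a , ⊖ b , IsPoly-⊖ {a} a-poly , IsPoly-⊖ {b} b-poly ,
      ≈ᴰ⇒≈D (≈ᴰ-trans (≈D⇒≈ᴰ ζ _ ζ≈) (≈ᴰ-trans (combination-cong {θ = θ} {θ} {η} {η} (⊖⊖ a) (⊖⊖ b) ≈ᴰ-refl ≈ᴰ-refl)
                                                  (≈ᴰ-sym (combination-⊖ (⊖ a) (⊖ b) θ η))))) ,
    (λ a b a-poly b-poly a⊖θ+b⊖η≈0 →
      let ⊖a≈0 , ⊖b≈0 = independent (⊖ a) (⊖ b) (IsPoly-⊖ {a} a-poly) (IsPoly-⊖ {b} b-poly)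
                          (≈ᴰ⇒≈D (≈ᴰ-trans (≈ᴰ-sym (combination-⊖ a b θ η)) (≈D⇒≈ᴰ _ 0D a⊖θ+b⊖η≈0)))
      in ⊖≈0 {a} ⊖a≈0 , ⊖≈0 {b} ⊖b≈0)
    where
    ⊖⊖ : ∀ a → a ≈ ⊖ (⊖ a)
    ⊖⊖ a = ≐⇒≈ λ i j → sym (ℤ.neg-involutive (a i j))
    ⊖≈0 : ∀ {a} → (⊖ a) ≈[ p ] 0S → a ≈[ p ] 0S
    ⊖≈0 {a} ⊖a≈0 = ≈⇒≈[p] (≈-trans (⊖⊖ a) (⊖-cong (≈[p]⇒≈ {⊖ a} {0S} ⊖a≈0)))

  mkθ-cong : ∀ μ {f f′ g g′} → f ≈ f′ → g ≈ g′ → mkθ μ f g ≈ᴰ mkθ μ f′ g′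
  mkθ-cong (μ₁ , μ₂ , _) f≈f′ g≈g′ = ⊛-cong (≈-refl {pow X μ₁}) f≈f′ , ⊛-cong (≈-refl {pow Y μ₂}) g≈g′

  mkθ-injective : ∀ μ {f f′ g g′} → mkθ μ f g ≈ᴰ mkθ μ f′ g′ → f ≈ f′ × g ≈ g′
  mkθ-injective (μ₁ , μ₂ , _) (xf≈xf′ , yg≈yg′) = powX⊛-injective μ₁ xf≈xf′ , powY⊛-injective μ₂ yg≈yg′

  mkθ-combination : ∀ μ a b f g f′ g′ →
    (a ·D mkθ μ f g) +D (b ·D mkθ μ f′ g′) ≈ᴰ mkθ μ (a ⊛ f ⊕ b ⊛ f′) (a ⊛ g ⊕ b ⊛ g′)
  mkθ-combination (μ₁ , μ₂ , _) a b f g f′ g′ = factor (pow X μ₁) f f′ , factor (pow Y μ₂) g g′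
    where
    factor : ∀ m f f′ → a ⊛ (m ⊛ f) ⊕ b ⊛ (m ⊛ f′) ≈ m ⊛ (a ⊛ f ⊕ b ⊛ f′)
    factor m f f′ = solve 5 (λ m a b f f′ → a :* (m :* f) :+ b :* (m :* f′) := m :* (a :* f :+ b :* f′)) ≈-refl m a b f f′

  mkθ-0S : ∀ μ → mkθ μ 0S 0S ≈ᴰ 0D
  mkθ-0S (μ₁ , μ₂ , _) = ⊛-zeroʳ (pow X μ₁) , ⊛-zeroʳ (pow Y μ₂)

  ⊛-⊖ : ∀ m f → m ⊛ ⊖ f ≈ ⊖ (m ⊛ f)
  ⊛-⊖ m f = solve 2 (λ m f → m :* (:- f) := :- (m :* f)) ≈-refl m f

  ⊖ᴰ-mkθ-⊖ : ∀ μ f g → ⊖ᴰ (mkθ μ (⊖ f) (⊖ g)) ≈ᴰ mkθ μ f g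
  ⊖ᴰ-mkθ-⊖ (μ₁ , μ₂ , _) f g = ⊖⊛⊖ (pow X μ₁) f , ⊖⊛⊖ (pow Y μ₂) g
    where
    ⊖⊛⊖ : ∀ m f → ⊖ (m ⊛ ⊖ f) ≈ m ⊛ f
    ⊖⊛⊖ m f = solve 2 (λ m f → :- (m :* (:- f)) := m :* f) ≈-refl m f

  mkθ∨≈mkθ : ∀ d μ f g → mkθ∨ p d μ f g ≈ᴰ mkθ (dualMult p d μ) g (⊖ f)
  mkθ∨≈mkθ d (μ₁ , μ₂ , _) f g = ≈-refl , ≈-sym (⊛-⊖ (pow Y (p ^ d ∸ μ₂)) f)

  mkθ∈D : ∀ {μ₁ μ₂ μ₃ f g} → IsPoly p f → IsPoly p g →
    DivS p ([x+y]^ μ₃) (pow X μ₁ ⊛ f ⊕ pow Y μ₂ ⊛ g) → InD p (μ₁ , μ₂ , μ₃) (mkθ (μ₁ , μ₂ , μ₃) f g)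
  mkθ∈D {μ₁} {μ₂} {μ₃} {f} {g} f-poly g-poly e∣θ =
    (IsPoly-⊛ {pow X μ₁} {f} (IsPoly-pow μ₁ (IsPoly-monomial 1 0)) f-poly ,
     IsPoly-⊛ {pow Y μ₂} {g} (IsPoly-pow μ₂ (IsPoly-monomial 0 1)) g-poly) ,
    (f , f-poly , ≈⇒≈[p] (≈-refl {pow X μ₁ ⊛ f})) , (g , g-poly , ≈⇒≈[p] (≈-refl {pow Y μ₂ ⊛ g})) , e∣θ

  InD⇒mkθ : ∀ μ θ → InD p μ θ → Σ Ser λ f → Σ Ser λ g → IsPoly p f × IsPoly p g × θ ≈ᴰ mkθ μ f g
  InD⇒mkθ (μ₁ , μ₂ , _) (P , Q) (_ , (f , f-poly , P≈xf) , (g , g-poly , Q≈yg) , _) =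
    f , g , f-poly , g-poly , ≈[p]⇒≈ {P} {pow X μ₁ ⊛ f} P≈xf , ≈[p]⇒≈ {Q} {pow Y μ₂ ⊛ g} Q≈yg

  1S≉0S : Prime p → ¬ 1S ≈[ p ] 0S
  1S≉0S p-prime 1≈0 = nonTrivial⇒≢1 {{prime⇒nonTrivial p-prime}} (∣1⇒≡1 (1≈0 0 0))

  IsBasis⇒≉0 : Prime p → ∀ μ {θ η} → IsBasis p μ θ η → ¬ θ ≈ᴰ 0D
  IsBasis⇒≉0 p-prime μ {θ@(P , Q)} {η@(P′ , Q′)} (_ , _ , _ , independent) θ≈0 =
    1S≉0S p-prime (proj₁ (independent 1S 0S (IsPoly-monomial 0 0) IsPoly-0S
      (≈ᴰ⇒≈D (≈ᴰ-trans (1·θ+0·η≈θ P P′ , 1·θ+0·η≈θ Q Q′) θ≈0))))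
    where
    1·θ+0·η≈θ : ∀ P P′ → 1S ⊛ P ⊕ 0S ⊛ P′ ≈ P
    1·θ+0·η≈θ P P′ = ≈-trans (⊕-cong (≐⇒≈ (⊛-identityˡ P)) (⊛-zeroˡ P′)) (⊕-identityʳ P)

  -- Homogeneous bases and their degrees

  Homogeneous : ℕ → Ser → Set
  Homogeneous k P = ∀ i j → i + j ≢ k → P i j ~ + 0

  Homogeneous-resp : ∀ {k f g} → f ≈ g → Homogeneous k f → Homogeneous k g
  Homogeneous-resp f≈g f-homog i j i+j≢k = ~-trans (~-sym (coeff f≈g i j)) (f-homog i j i+j≢k)

  Homogeneous-⊖ : ∀ {k f} → Homogeneous k f → Homogeneous k (⊖ f)
  Homogeneous-⊖ f-homog i j i+j≢k = ~-neg (f-homog i j i+j≢k)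

  HomogeneousD : ℕ → Der → Set
  HomogeneousD k (P , Q) = Homogeneous k P × Homogeneous k Q

  HomogDeg⇒HomogeneousD : ∀ θ k → HomogDeg p θ k → HomogeneousD k θ
  HomogDeg⇒HomogeneousD (P , Q) k homog =
    (λ i j i+j≢k → p∣⇒~0 (proj₁ (homog i j i+j≢k))) , (λ i j i+j≢k → p∣⇒~0 (proj₂ (homog i j i+j≢k)))

  HomogeneousD-resp : ∀ {k θ η} → θ ≈ᴰ η → HomogeneousD k θ → HomogeneousD k η
  HomogeneousD-resp {θ = P , Q} {P′ , Q′} (P≈ , Q≈) (P-homog , Q-homog) =
    Homogeneous-resp P≈ P-homog , Homogeneous-resp Q≈ Q-homog

  -- The part of a that multiplies forms of degree k into degree n (zero when k > n).
  slice : ℕ → ℕ → Ser → Ser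
  slice n k a α β with α + β + k ≟ n
  ... | yes _ = a α β
  ... | no  _ = + 0

  slice-on : ∀ n k a {α β} → α + β + k ≡ n → slice n k a α β ≡ a α β
  slice-on n k a {α} {β} on with α + β + k ≟ n
  ... | yes _  = refl
  ... | no off = ⊥-elim (off on)

  slice-off : ∀ n k a {α β} → α + β + k ≢ n → slice n k a α β ≡ + 0
  slice-off n k a {α} {β} off with α + β + k ≟ n
  ... | yes on = ⊥-elim (off on)
  ... | no _   = refl

  slice-below : ∀ {n k} a → n < k → slice n k a ≈ 0S
  slice-below {n} {k} a n<k = ≐⇒≈ λ α β → slice-off n k a {α} {β} λ α+β+k≡n →
    <-irrefl refl (<-≤-trans n<k (subst (k ≤_) α+β+k≡n (m≤n+m k (α + β))))

  IsPoly-slice : ∀ n k a → IsPoly p (slice n k a)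
  IsPoly-slice n k a = mkPoly (suc n) λ α β n<α+β → ≡⇒~ (slice-off n k a {α} {β} λ α+β+k≡n →
    <-irrefl refl (<-≤-trans n<α+β (subst (α + β ≤_) α+β+k≡n (m≤m+n (α + β) k))))

  module _ {k P} (P-homog : Homogeneous k P) (n : ℕ) (a : Ser) where

    private
      term-on : ∀ {i j α β} → α ≤ i → β ≤ j → i + j ≡ n →
        a α β *ℤ P (i ∸ α) (j ∸ β) ~ slice n k a α β *ℤ P (i ∸ α) (j ∸ β)
      term-on {i} {j} {α} {β} α≤i β≤j i+j≡n with (i ∸ α) + (j ∸ β) ≟ k
      ... | yes rest≡k = ≡⇒~ (cong (_*ℤ P (i ∸ α) (j ∸ β)) (sym (slice-on n k a (begin
            α + β + k                       ≡⟨ cong (_+_ (α + β)) rest≡k ⟨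
            α + β + (i ∸ α + (j ∸ β))       ≡⟨ [a+b]+[i∸a+j∸b]≡i+j α≤i β≤j ⟩
            i + j                           ≡⟨ i+j≡n ⟩
            n                               ∎))))
        where open ≡-Reasoning
      ... | no  rest≢k = ~-trans (~0-*ʳ (a α β) (P-homog _ _ rest≢k)) (~-sym (~0-*ʳ (slice n k a α β) (P-homog _ _ rest≢k)))

      term-off : ∀ {i j α β} → α ≤ i → β ≤ j → i + j ≢ n → slice n k a α β *ℤ P (i ∸ α) (j ∸ β) ~ + 0
      term-off {i} {j} {α} {β} α≤i β≤j i+j≢n with α + β + k ≟ n
      ... | no  _  = ≡⇒~ (ℤ.*-zeroˡ (P (i ∸ α) (j ∸ β)))
      ... | yes on = ~0-*ʳ (a α β) (P-homog _ _ λ rest≡k → i+j≢n (begin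
            i + j                           ≡⟨ [a+b]+[i∸a+j∸b]≡i+j α≤i β≤j ⟨
            α + β + (i ∸ α + (j ∸ β))       ≡⟨ cong (_+_ (α + β)) rest≡k ⟩
            α + β + k                       ≡⟨ on ⟩
            n                               ∎))
        where open ≡-Reasoning

    ⊛-slice-on : ∀ i j → i + j ≡ n → (a ⊛ P) i j ~ (slice n k a ⊛ P) i j
    ⊛-slice-on i j i+j≡n = sumTo-~ (suc i) λ α α<1+i → sumTo-~ (suc j) λ β β<1+j →
      term-on (≤-pred α<1+i) (≤-pred β<1+j) i+j≡n

    slice⊛-homogeneous : Homogeneous n (slice n k a ⊛ P)
    slice⊛-homogeneous i j i+j≢n = sumTo-~0 (suc i) λ α α<1+i → sumTo-~0 (suc j) λ β β<1+j →
      term-off (≤-pred α<1+i) (≤-pred β<1+j) i+j≢n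

  combination-slice : ∀ {n k l Z P P′} a b → Homogeneous n Z → Homogeneous k P → Homogeneous l P′ →
    Z ≈ a ⊛ P ⊕ b ⊛ P′ → Z ≈ slice n k a ⊛ P ⊕ slice n l b ⊛ P′
  combination-slice {n} {k} {l} {Z} {P} {P′} a b Z-homog P-homog P′-homog Z≈ = mk≈ λ i j → coefficient i j
    where
    coefficient : ∀ i j → Z i j ~ (slice n k a ⊛ P) i j +ℤ (slice n l b ⊛ P′) i j
    coefficient i j with i + j ≟ n
    ... | yes i+j≡n = ~-trans (coeff Z≈ i j) (~-+ (⊛-slice-on P-homog n a i j i+j≡n) (⊛-slice-on P′-homog n b i j i+j≡n))
    ... | no  i+j≢n = ~-trans (Z-homog i j i+j≢n)
      (~-sym (~-+ (slice⊛-homogeneous P-homog n a i j i+j≢n) (slice⊛-homogeneous P′-homog n b i j i+j≢n)))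

  combination-0S : ∀ θ η → (0S ·D θ) +D (0S ·D η) ≈ᴰ 0D
  combination-0S (P , Q) (P′ , Q′) = zero₂ P P′ , zero₂ Q Q′
    where
    zero₂ : ∀ P P′ → 0S ⊛ P ⊕ 0S ⊛ P′ ≈ 0S
    zero₂ P P′ = ≈-trans (⊕-cong (⊛-zeroˡ P) (⊛-zeroˡ P′)) (⊕-identityʳ 0S)

  homogeneous-expansion : ∀ ν {θ η k l ζ n} → IsBasis p ν θ η → HomogeneousD k θ → HomogeneousD l η →
    InD p ν ζ → HomogeneousD n ζ → Σ Ser λ a → Σ Ser λ b → ζ ≈ᴰ (slice n k a ·D θ) +D (slice n l b ·D η)
  homogeneous-expansion ν {P , Q} {P′ , Q′} {k} {l} {ζ@(Z , W)} {n}
                        (_ , _ , spans , _) (P-homog , Q-homog) (P′-homog , Q′-homog) ζ∈D (Z-homog , W-homog) =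
    let a , b , _ , _ , ζ≈ = spans ζ ζ∈D
        Z≈ , W≈ = ≈D⇒≈ᴰ ζ _ ζ≈
    in a , b , combination-slice a b Z-homog P-homog P′-homog Z≈ , combination-slice a b W-homog Q-homog Q′-homog W≈

  basis-⊓-≤ : ∀ ν {θ η k l ζ n} → IsBasis p ν θ η → HomogeneousD k θ → HomogeneousD l η →
    InD p ν ζ → HomogeneousD n ζ → ¬ ζ ≈ᴰ 0D → k ⊓ l ≤ n
  basis-⊓-≤ ν {θ} {η} {k} {l} {ζ} {n} basis θ-homog η-homog ζ∈D ζ-homog ζ≉0 with k ⊓ l ≤? n
  ... | yes k⊓l≤n = k⊓l≤n
  ... | no  k⊓l≰n =
    let a , b , ζ≈ = homogeneous-expansion ν {θ} {η} {k} {l} {ζ} {n} basis θ-homog η-homog ζ∈D ζ-homog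
        n<k⊓l = ≰⇒> k⊓l≰n
    in ⊥-elim (ζ≉0 (≈ᴰ-trans ζ≈ (≈ᴰ-trans
         (combination-cong {slice n k a} {0S} {slice n l b} {0S} {θ} {θ} {η} {η}
           (slice-below a (<-≤-trans n<k⊓l (m⊓n≤m k l))) (slice-below b (<-≤-trans n<k⊓l (m⊓n≤n k l))) ≈ᴰ-refl ≈ᴰ-refl)
         (combination-0S θ η))))

  multiple-of-first : ∀ ν {η η′ l l′ θ k} → IsBasis p ν η η′ → HomogeneousD l η → HomogeneousD l′ η′ →
    InD p ν θ → HomogeneousD k θ → k < l′ → Σ Ser λ a → IsPoly p a × θ ≈ᴰ a ·D η
  multiple-of-first ν {η@(R , S)} {η′@(R′ , S′)} {l} {l′} {θ} {k} basis η-homog η′-homog θ∈D θ-homog k<l′ =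
    let a , b , θ≈ = homogeneous-expansion ν {η} {η′} {l} {l′} {θ} {k} basis η-homog η′-homog θ∈D θ-homog
        b≈0 = slice-below b k<l′
    in slice k l a , IsPoly-slice k l a ,
       ≈ᴰ-trans θ≈ (drop (slice k l a) (slice k l′ b) b≈0 R R′ , drop (slice k l a) (slice k l′ b) b≈0 S S′)
    where
    drop : ∀ a b → b ≈ 0S → ∀ R R′ → a ⊛ R ⊕ b ⊛ R′ ≈ a ⊛ R
    drop a b b≈0 R R′ = ≈-trans (⊕-cong (≈-refl {a ⊛ R}) (≈-trans (⊛-cong b≈0 (≈-refl {R′})) (⊛-zeroˡ R′))) (⊕-identityʳ (a ⊛ R))

  -- Two multiples a η, a′ η of one element are dependent: a′ (a η) - a (a′ η) = 0.
  basis-not-multiples : Prime p → ∀ ν {θ θ′ η a a′} → IsBasis p ν θ θ′ → IsPoly p a → IsPoly p a′ →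
    θ ≈ᴰ a ·D η → θ′ ≈ᴰ a′ ·D η → ⊥
  basis-not-multiples p-prime ν {θ@(P , Q)} {θ′@(P′ , Q′)} {η@(R , S)} {a} {a′} basis a-poly a′-poly θ≈aη θ′≈a′η =
    IsBasis⇒≉0 p-prime ν {θ} {θ′} basis (≈ᴰ-trans θ≈aη (a≈0⇒ R , a≈0⇒ S))
    where
    open _≈ᴰ_
    dependent : ∀ P P′ R → P ≈ a ⊛ R → P′ ≈ a′ ⊛ R → a′ ⊛ P ⊕ (⊖ a) ⊛ P′ ≈ 0S
    dependent P P′ R P≈ P′≈ = ≈-trans (⊕-cong (⊛-cong (≈-refl {a′}) P≈) (⊛-cong (≈-refl {⊖ a}) P′≈))
      (≈-trans (solve 3 (λ a a′ R → a′ :* (a :* R) :+ (:- a) :* (a′ :* R) := con (+ 0)) ≈-refl a a′ R) (≐⇒≈ λ _ _ → refl))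
    ⊖a≈0 : (⊖ a) ≈[ p ] 0S
    ⊖a≈0 = proj₂ (proj₂ (proj₂ (proj₂ basis)) a′ (⊖ a) a′-poly (IsPoly-⊖ {a} a-poly)
             (≈ᴰ⇒≈D (dependent P P′ R (∂x θ≈aη) (∂x θ′≈a′η) , dependent Q Q′ S (∂y θ≈aη) (∂y θ′≈a′η))))
    a≈0⇒ : ∀ R → a ⊛ R ≈ 0S
    a≈0⇒ R = ≈-trans (⊛-cong (≈-trans (≐⇒≈ λ i j → sym (ℤ.neg-involutive (a i j))) (⊖-cong (≈[p]⇒≈ {⊖ a} {0S} ⊖a≈0)))
                              (≈-refl {R}))
                     (⊛-zeroˡ R)

  basis-≤-⊔ : Prime p → ∀ ν {θ θ′ k k′ η η′ l l′} →
    IsBasis p ν θ θ′ → HomogeneousD k θ → HomogeneousD k′ θ′ →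
    IsBasis p ν η η′ → HomogeneousD l η → HomogeneousD l′ η′ → l′ ≤ k ⊔ k′
  basis-≤-⊔ p-prime ν {θ} {θ′} {k} {k′} {η} {η′} {l} {l′} θ-basis θ-homog θ′-homog η-basis η-homog η′-homog
    with l′ ≤? k ⊔ k′
  ... | yes l′≤k⊔k′ = l′≤k⊔k′
  ... | no  l′≰k⊔k′ =
    let k⊔k′<l′ = ≰⇒> l′≰k⊔k′
        a  , a-poly  , θ≈aη   = multiple-of-first ν {η} {η′} {l} {l′} {θ} {k} η-basis η-homog η′-homog
                                  (proj₁ θ-basis) θ-homog (≤-<-trans (m≤m⊔n k k′) k⊔k′<l′)
        a′ , a′-poly , θ′≈a′η = multiple-of-first ν {η} {η′} {l} {l′} {θ′} {k′} η-basis η-homog η′-homog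
                                  (proj₁ (proj₂ θ-basis)) θ′-homog (≤-<-trans (m≤n⊔m k k′) k⊔k′<l′)
    in ⊥-elim (basis-not-multiples p-prime ν {θ} {θ′} {η} {a} {a′} θ-basis a-poly a′-poly θ≈aη θ′≈a′η)

  basis-⊓-≤-⊓ : Prime p → ∀ ν {θ θ′ k k′ η η′ l l′} →
    IsBasis p ν θ θ′ → HomogeneousD k θ → HomogeneousD k′ θ′ →
    IsBasis p ν η η′ → HomogeneousD l η → HomogeneousD l′ η′ → k ⊓ k′ ≤ l ⊓ l′
  basis-⊓-≤-⊓ p-prime ν {θ} {θ′} {k} {k′} {η} {η′} {l} {l′} θ-basis θ-homog θ′-homog η-basis η-homog η′-homog =
    ⊓-glb (basis-⊓-≤ ν {θ} {θ′} {k} {k′} {η} {l} θ-basis θ-homog θ′-homog (proj₁ η-basis) η-homog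
             (IsBasis⇒≉0 p-prime ν {η} {η′} η-basis))
          (basis-⊓-≤ ν {θ} {θ′} {k} {k′} {η′} {l′} θ-basis θ-homog θ′-homog (proj₁ (proj₂ η-basis)) η′-homog
             (IsBasis⇒≉0 p-prime ν {η′} {η} (IsBasis-swap ν {η} {η′} η-basis)))

  basis-⊔-≤-⊔ : Prime p → ∀ ν {θ θ′ k k′ η η′ l l′} →
    IsBasis p ν θ θ′ → HomogeneousD k θ → HomogeneousD k′ θ′ →
    IsBasis p ν η η′ → HomogeneousD l η → HomogeneousD l′ η′ → l ⊔ l′ ≤ k ⊔ k′
  basis-⊔-≤-⊔ p-prime ν {θ} {θ′} {k} {k′} {η} {η′} {l} {l′} θ-basis θ-homog θ′-homog η-basis η-homog η′-homog =
    ⊔-lub (basis-≤-⊔ p-prime ν {θ} {θ′} {k} {k′} {η′} {η} {l′} {l} θ-basis θ-homog θ′-homog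
             (IsBasis-swap ν {η} {η′} η-basis) η′-homog η-homog)
          (basis-≤-⊔ p-prime ν {θ} {θ′} {k} {k′} {η} {η′} {l} {l′} θ-basis θ-homog θ′-homog η-basis η-homog η′-homog)

  exponents-unique : Prime p → ∀ ν {θ θ′ k k′ η η′ l l′} →
    IsBasis p ν θ θ′ → HomogeneousD k θ → HomogeneousD k′ θ′ →
    IsBasis p ν η η′ → HomogeneousD l η → HomogeneousD l′ η′ → ∣ k - k′ ∣ ≡ ∣ l - l′ ∣
  exponents-unique p-prime ν {θ} {θ′} {k} {k′} {η} {η′} {l} {l′} θ-basis θ-homog θ′-homog η-basis η-homog η′-homog =
    begin
      ∣ k - k′ ∣          ≡⟨ ∣m-n∣≡m⊔n∸m⊓n k k′ ⟩
      k ⊔ k′ ∸ k ⊓ k′     ≡⟨ cong₂ _∸_ ⊔≡ ⊓≡ ⟩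
      l ⊔ l′ ∸ l ⊓ l′     ≡⟨ ∣m-n∣≡m⊔n∸m⊓n l l′ ⟨
      ∣ l - l′ ∣          ∎
    where
    open ≡-Reasoning
    ⊓≡ : k ⊓ k′ ≡ l ⊓ l′
    ⊓≡ = ≤-antisym
      (basis-⊓-≤-⊓ p-prime ν {θ} {θ′} {k} {k′} {η} {η′} {l} {l′} θ-basis θ-homog θ′-homog η-basis η-homog η′-homog)
      (basis-⊓-≤-⊓ p-prime ν {η} {η′} {l} {l′} {θ} {θ′} {k} {k′} η-basis η-homog η′-homog θ-basis θ-homog θ′-homog)
    ⊔≡ : k ⊔ k′ ≡ l ⊔ l′
    ⊔≡ = ≤-antisym
      (basis-⊔-≤-⊔ p-prime ν {η} {η′} {l} {l′} {θ} {θ′} {k} {k′} η-basis η-homog η′-homog θ-basis θ-homog θ′-homog)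
      (basis-⊔-≤-⊔ p-prime ν {θ} {θ′} {k} {k′} {η} {η′} {l} {l′} θ-basis θ-homog θ′-homog η-basis η-homog η′-homog)

  -- The coefficient of x^(u′+i) y^(v′+j) in x^u′ y^v′ F is that of x^(u+i) y^(v+j) in x^u y^v F.
  monomial⊛-regrade : ∀ {u v k F} → Homogeneous k (monomial u v ⊛ F) → ∀ u′ v′ i j →
    i + j + (u + v) ≢ k + (u′ + v′) → (monomial u′ v′ ⊛ F) i j ~ + 0
  monomial⊛-regrade {u} {v} {k} {F} uvF-homog u′ v′ i j off with u′ ≤? i | v′ ≤? j
  ... | no u′≰i  | _        = ≡⇒~ (monomial⊛-below u′ v′ F i j (inj₁ (≰⇒> u′≰i)))
  ... | yes _    | no v′≰j  = ≡⇒~ (monomial⊛-below u′ v′ F i j (inj₂ (≰⇒> v′≰j)))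
  ... | yes u′≤i | yes v′≤j = ~-trans (≡⇒~ (begin
        (monomial u′ v′ ⊛ F) i j                         ≡⟨ cong₂ (monomial u′ v′ ⊛ F) (m+[n∸m]≡n u′≤i) (m+[n∸m]≡n v′≤j) ⟨
        (monomial u′ v′ ⊛ F) (u′ + i₀) (v′ + j₀)         ≡⟨ monomial⊛-shift u′ v′ F i₀ j₀ ⟩
        F i₀ j₀                                          ≡⟨ monomial⊛-shift u v F i₀ j₀ ⟨
        (monomial u v ⊛ F) (u + i₀) (v + j₀)             ∎))
      (uvF-homog (u + i₀) (v + j₀) λ on → off (begin
        i + j + (u + v)                                  ≡⟨ cong₂ (λ i j → i + j + (u + v)) (m+[n∸m]≡n u′≤i) (m+[n∸m]≡n v′≤j) ⟨
        (u′ + i₀) + (v′ + j₀) + (u + v)                  ≡⟨ regroup u v u′ v′ i₀ j₀ ⟩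
        (u + i₀ + (v + j₀)) + (u′ + v′)                  ≡⟨ cong (_+ (u′ + v′)) on ⟩
        k + (u′ + v′)                                    ∎))
    where
    open ≡-Reasoning
    i₀ = i ∸ u′
    j₀ = j ∸ v′
    regroup : ∀ u v u′ v′ i₀ j₀ → (u′ + i₀) + (v′ + j₀) + (u + v) ≡ (u + i₀ + (v + j₀)) + (u′ + v′)
    regroup = ℕ-Solver.solve-∀

  -- The duality μ ↦ μ^∨

  module _ (p-prime : Prime p) (d : ℕ) where

    private
      N = p ^ d

    frobenius : [x+y]^ (p ^ d) ≈ pow X (p ^ d) ⊕ pow Y (p ^ d)
    frobenius = [x+y]^≈ (p ^ d) (≢-nonZero⁻¹ (p ^ d) {{m^n≢0 p d {{prime⇒nonZero p-prime}}}}) (prime∣[p^d]Ck p-prime d)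

    -- The cofactor Q comes from x^a (x^(N-a) g - y^(N-b) f) = (x+y)^m (x+y)^(N-m) g - y^(N-b) (x^a f + y^b g).
    [x+y]^∣-dual : ∀ {a b m f g} → a ≤ p ^ d → b ≤ p ^ d → m ≤ p ^ d → IsPoly p g →
      DivS p ([x+y]^ m) (pow X a ⊛ f ⊕ pow Y b ⊛ g) →
      DivS p ([x+y]^ m) (pow X (p ^ d ∸ a) ⊛ g ⊕ pow Y (p ^ d ∸ b) ⊛ ⊖ f)
    [x+y]^∣-dual {a} {b} {m} {f} {g} a≤N b≤N m≤N g-poly (q , q-poly , e∣xᵃf+yᵇg) =
      [x+y]^∣powX⊛⇒∣ m a {pow X (p ^ d ∸ a) ⊛ g ⊕ pow Y (p ^ d ∸ b) ⊛ ⊖ f} (Q , Q-poly , ≈⇒≈[p] (begin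
        xᵃ ⊛ (xᴺ⁻ᵃ ⊛ g ⊕ yᴺ⁻ᵇ ⊛ ⊖ f)
          ≈⟨ solve 6 (λ xᵃ xᴺ⁻ᵃ yᵇ yᴺ⁻ᵇ f g → xᵃ :* (xᴺ⁻ᵃ :* g :+ yᴺ⁻ᵇ :* (:- f))
                   := (xᵃ :* xᴺ⁻ᵃ :+ yᵇ :* yᴺ⁻ᵇ) :* g :- yᴺ⁻ᵇ :* (xᵃ :* f :+ yᵇ :* g)) ≈-refl xᵃ xᴺ⁻ᵃ yᵇ yᴺ⁻ᵇ f g ⟩
        (xᵃ ⊛ xᴺ⁻ᵃ ⊕ yᵇ ⊛ yᴺ⁻ᵇ) ⊛ g ⊕ ⊖ (yᴺ⁻ᵇ ⊛ (xᵃ ⊛ f ⊕ yᵇ ⊛ g))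
          ≈⟨ ⊕-cong (⊛-cong (⊕-cong (pow-+-∸ X a≤N) (pow-+-∸ Y b≤N)) (≈-refl {g}))
                    (⊖-cong (⊛-cong (≈-refl {yᴺ⁻ᵇ}) (≈[p]⇒≈ {xᵃ ⊛ f ⊕ yᵇ ⊛ g} {eᵐ ⊛ q} e∣xᵃf+yᵇg))) ⟩
        (pow X N ⊕ pow Y N) ⊛ g ⊕ ⊖ (yᴺ⁻ᵇ ⊛ (eᵐ ⊛ q))
          ≈⟨ ⊕-cong (⊛-cong (≈-trans (≈-sym frobenius) (≈-sym (pow-+-∸ (X ⊕ Y) m≤N))) (≈-refl {g}))
                    (≈-refl {⊖ (yᴺ⁻ᵇ ⊛ (eᵐ ⊛ q))}) ⟩
        (eᵐ ⊛ eᴺ⁻ᵐ) ⊛ g ⊕ ⊖ (yᴺ⁻ᵇ ⊛ (eᵐ ⊛ q))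
          ≈⟨ solve 5 (λ eᵐ eᴺ⁻ᵐ yᴺ⁻ᵇ g q → (eᵐ :* eᴺ⁻ᵐ) :* g :- yᴺ⁻ᵇ :* (eᵐ :* q) := eᵐ :* (eᴺ⁻ᵐ :* g :+ yᴺ⁻ᵇ :* (:- q)))
               ≈-refl eᵐ eᴺ⁻ᵐ yᴺ⁻ᵇ g q ⟩
        eᵐ ⊛ Q ∎))
      where
      open ≈-Reasoning
      xᵃ = pow X a
      xᴺ⁻ᵃ = pow X (N ∸ a)
      yᵇ = pow Y b
      yᴺ⁻ᵇ = pow Y (N ∸ b)
      eᵐ = [x+y]^ m
      eᴺ⁻ᵐ = [x+y]^ (N ∸ m)
      Q = eᴺ⁻ᵐ ⊛ g ⊕ yᴺ⁻ᵇ ⊛ ⊖ q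
      Q-poly : IsPoly p Q
      Q-poly = IsPoly-⊕ {eᴺ⁻ᵐ ⊛ g} {yᴺ⁻ᵇ ⊛ ⊖ q}
        (IsPoly-⊛ {eᴺ⁻ᵐ} {g} (IsPoly-pow (N ∸ m) (IsPoly-⊕ {X} {Y} (IsPoly-monomial 1 0) (IsPoly-monomial 0 1))) g-poly)
        (IsPoly-⊛ {yᴺ⁻ᵇ} {⊖ q} (IsPoly-pow (N ∸ b) (IsPoly-monomial 0 1)) (IsPoly-⊖ {q} q-poly))

    InBox-dual : ∀ {μ} → InBox p d μ → InBox p d (dualMult p d μ)
    InBox-dual {μ₁ , μ₂ , _} (_ , _ , μ₃≤N) = m∸n≤m (p ^ d) μ₁ , m∸n≤m (p ^ d) μ₂ , μ₃≤N

    dualMult-involutive : ∀ {μ} → InBox p d μ → dualMult p d (dualMult p d μ) ≡ μ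
    dualMult-involutive (μ₁≤N , μ₂≤N , _) = cong₂ _,_ (m∸[m∸n]≡n μ₁≤N) (cong (_, _) (m∸[m∸n]≡n μ₂≤N))

    mkθ∈D-dual : ∀ {μ f g} → InBox p d μ → IsPoly p f → IsPoly p g →
      InD p μ (mkθ μ f g) → InD p (dualMult p d μ) (mkθ (dualMult p d μ) g (⊖ f))
    mkθ∈D-dual {μ₁ , μ₂ , μ₃} {f} {g} (μ₁≤N , μ₂≤N , μ₃≤N) f-poly g-poly (_ , _ , _ , e∣θ) =
      mkθ∈D {p ^ d ∸ μ₁} {p ^ d ∸ μ₂} {μ₃} {g} {⊖ f} g-poly (IsPoly-⊖ {f} f-poly)
        ([x+y]^∣-dual {μ₁} {μ₂} {μ₃} {f} {g} μ₁≤N μ₂≤N μ₃≤N g-poly e∣θ)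

    -- Spanning: η = mkθ ν F G is the dual of -(G, -F), and mkθ μ G (-F) ∈ D(A, μ) by dualising twice.
    IsBasis-dual : ∀ {μ f g f′ g′} → InBox p d μ → IsPoly p f → IsPoly p g → IsPoly p f′ → IsPoly p g′ →
      IsBasis p μ (mkθ μ f g) (mkθ μ f′ g′) →
      IsBasis p (dualMult p d μ) (mkθ (dualMult p d μ) g (⊖ f)) (mkθ (dualMult p d μ) g′ (⊖ f′))
    IsBasis-dual {μ} {f} {g} {f′} {g′} μ∈box f-poly g-poly f′-poly g′-poly (θ∈D , θ′∈D , spans , independent) =
      mkθ∈D-dual {μ} {f} {g} μ∈box f-poly g-poly θ∈D , mkθ∈D-dual {μ} {f′} {g′} μ∈box f′-poly g′-poly θ′∈D ,
      spans∨ , independent∨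
      where
      ν = dualMult p d μ

      spans∨ : ∀ η → InD p ν η → Σ Ser λ a → Σ Ser λ b → IsPoly p a × IsPoly p b ×
        (η ≈D[ p ] ((a ·D mkθ ν g (⊖ f)) +D (b ·D mkθ ν g′ (⊖ f′))))
      spans∨ η η∈D =
        let F , G , F-poly , G-poly , η≈ = InD⇒mkθ ν η η∈D
            ζ∈D = subst (λ μ′ → InD p μ′ (mkθ μ′ G (⊖ F))) (dualMult-involutive μ∈box)
                    (mkθ∈D-dual {ν} {F} {G} (InBox-dual μ∈box) F-poly G-poly (InD-resp ν η≈ η∈D))
            a , b , a-poly , b-poly , ζ≈ = spans (mkθ μ G (⊖ F)) ζ∈D
            G≈ , ⊖F≈ = mkθ-injective μ {G} {a ⊛ f ⊕ b ⊛ f′} {⊖ F} {a ⊛ g ⊕ b ⊛ g′}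
                         (≈ᴰ-trans (≈D⇒≈ᴰ _ _ ζ≈) (mkθ-combination μ a b f g f′ g′))
        in ⊖ a , ⊖ b , IsPoly-⊖ {a} a-poly , IsPoly-⊖ {b} b-poly ,
           ≈ᴰ⇒≈D (≈ᴰ-trans η≈ (≈ᴰ-trans
             (mkθ-cong ν {F} {(⊖ a) ⊛ g ⊕ (⊖ b) ⊛ g′} {G} {(⊖ a) ⊛ (⊖ f) ⊕ (⊖ b) ⊛ (⊖ f′)}
                       (F-expansion a b F ⊖F≈) (G-expansion a b G G≈))
             (≈ᴰ-sym (mkθ-combination ν (⊖ a) (⊖ b) g (⊖ f) g′ (⊖ f′)))))
        where
        F-expansion : ∀ a b F → ⊖ F ≈ a ⊛ g ⊕ b ⊛ g′ → F ≈ (⊖ a) ⊛ g ⊕ (⊖ b) ⊛ g′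
        F-expansion a b F ⊖F≈ = ≈-trans (≐⇒≈ λ i j → sym (ℤ.neg-involutive (F i j))) (≈-trans (⊖-cong ⊖F≈)
          (solve 4 (λ a b g g′ → :- (a :* g :+ b :* g′) := (:- a) :* g :+ (:- b) :* g′) ≈-refl a b g g′))
        G-expansion : ∀ a b G → G ≈ a ⊛ f ⊕ b ⊛ f′ → G ≈ (⊖ a) ⊛ (⊖ f) ⊕ (⊖ b) ⊛ (⊖ f′)
        G-expansion a b G G≈ = ≈-trans G≈
          (solve 4 (λ a b f f′ → a :* f :+ b :* f′ := (:- a) :* (:- f) :+ (:- b) :* (:- f′)) ≈-refl a b f f′)

      independent∨ : ∀ a b → IsPoly p a → IsPoly p b →
        ((a ·D mkθ ν g (⊖ f)) +D (b ·D mkθ ν g′ (⊖ f′))) ≈D[ p ] 0D → (a ≈[ p ] 0S) × (b ≈[ p ] 0S)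
      independent∨ a b a-poly b-poly combination≈0 =
        let ag+bg′≈0 , a⊖f+b⊖f′≈0 = mkθ-injective ν {a ⊛ g ⊕ b ⊛ g′} {0S} {a ⊛ (⊖ f) ⊕ b ⊛ (⊖ f′)} {0S}
              (≈ᴰ-trans (≈ᴰ-sym (mkθ-combination ν a b g (⊖ f) g′ (⊖ f′)))
                        (≈ᴰ-trans (≈D⇒≈ᴰ _ 0D combination≈0) (≈ᴰ-sym (mkθ-0S ν))))
            af+bf′≈0 = ≈-trans (solve 4 (λ a b f f′ → a :* f :+ b :* f′ := :- (a :* (:- f) :+ b :* (:- f′))) ≈-refl a b f f′)
                               (≈-trans (⊖-cong a⊖f+b⊖f′≈0) (≐⇒≈ λ _ _ → refl))
        in independent a b a-poly b-poly (≈ᴰ⇒≈D (≈ᴰ-trans (mkθ-combination μ a b f g f′ g′)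
          (≈ᴰ-trans (mkθ-cong μ {a ⊛ f ⊕ b ⊛ f′} {0S} {a ⊛ g ⊕ b ⊛ g′} {0S} af+bf′≈0 ag+bg′≈0) (mkθ-0S μ))))

    IsBasis-dual⇔ : ∀ {μ f g f′ g′} → InBox p d μ → IsPoly p f → IsPoly p g → IsPoly p f′ → IsPoly p g′ →
      IsBasis p μ (mkθ μ f g) (mkθ μ f′ g′) ⇔ IsBasis p (dualMult p d μ) (mkθ∨ p d μ f g) (mkθ∨ p d μ f′ g′)
    IsBasis-dual⇔ {μ} {f} {g} {f′} {g′} μ∈box f-poly g-poly f′-poly g′-poly = mk⇔ to from
      where
      ν = dualMult p d μ
      to : IsBasis p μ (mkθ μ f g) (mkθ μ f′ g′) → IsBasis p ν (mkθ∨ p d μ f g) (mkθ∨ p d μ f′ g′)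
      to θ-basis = IsBasis-resp ν {mkθ ν g (⊖ f)} {mkθ∨ p d μ f g} {mkθ ν g′ (⊖ f′)} {mkθ∨ p d μ f′ g′}
        (≈ᴰ-sym (mkθ∨≈mkθ d μ f g)) (≈ᴰ-sym (mkθ∨≈mkθ d μ f′ g′))
        (IsBasis-dual {μ} {f} {g} {f′} {g′} μ∈box f-poly g-poly f′-poly g′-poly θ-basis)
      from : IsBasis p ν (mkθ∨ p d μ f g) (mkθ∨ p d μ f′ g′) → IsBasis p μ (mkθ μ f g) (mkθ μ f′ g′)
      from θ∨-basis = IsBasis-resp μ {⊖ᴰ (mkθ μ (⊖ f) (⊖ g))} {mkθ μ f g} {⊖ᴰ (mkθ μ (⊖ f′) (⊖ g′))} {mkθ μ f′ g′}
        (⊖ᴰ-mkθ-⊖ μ f g) (⊖ᴰ-mkθ-⊖ μ f′ g′) (IsBasis-⊖ μ {mkθ μ (⊖ f) (⊖ g)} {mkθ μ (⊖ f′) (⊖ g′)} double-dual)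
        where
        double-dual : IsBasis p μ (mkθ μ (⊖ f) (⊖ g)) (mkθ μ (⊖ f′) (⊖ g′))
        double-dual = subst (λ μ′ → IsBasis p μ′ (mkθ μ′ (⊖ f) (⊖ g)) (mkθ μ′ (⊖ f′) (⊖ g′))) (dualMult-involutive μ∈box)
          (IsBasis-dual {ν} {g} {⊖ f} {g′} {⊖ f′} (InBox-dual μ∈box) g-poly (IsPoly-⊖ {f} f-poly) g′-poly (IsPoly-⊖ {f′} f′-poly)
            (IsBasis-resp ν {mkθ∨ p d μ f g} {mkθ ν g (⊖ f)} {mkθ∨ p d μ f′ g′} {mkθ ν g′ (⊖ f′)}
              (mkθ∨≈mkθ d μ f g) (mkθ∨≈mkθ d μ f′ g′) θ∨-basis))

    mkθ-dual-vanishes : ∀ {μ₁ μ₂ μ₃ F G k} → μ₁ ≤ p ^ d → μ₂ ≤ p ^ d → HomogeneousD k (mkθ (μ₁ , μ₂ , μ₃) F G) →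
      ∀ i j → i + j + (μ₁ + μ₂) ≢ k + p ^ d →
      ((pow X (p ^ d ∸ μ₁) ⊛ G) i j ~ + 0) × ((pow Y (p ^ d ∸ μ₂) ⊛ ⊖ F) i j ~ + 0)
    mkθ-dual-vanishes {μ₁} {μ₂} {μ₃} {F} {G} {k} μ₁≤N μ₂≤N (xF-homog , yG-homog) i j off =
      ~-trans (≡⇒~ (⊛-congˡ G (pow-X (N ∸ μ₁)) i j))
        (monomial⊛-regrade {0} {μ₂} {k} {G} (Homogeneous-resp (≐⇒≈ (⊛-congˡ G (pow-Y μ₂))) yG-homog) (N ∸ μ₁) 0 i j
          λ on → off (trans (+-comm-middle (i + j) μ₁ μ₂)
                            (regrade {i + j} {μ₁} {μ₂} μ₁≤N (trans on (cong (_+_ k) (+-identityʳ (N ∸ μ₁))))))) ,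
      ~-trans (≡⇒~ (⊛-congˡ (⊖ F) (pow-Y (N ∸ μ₂)) i j))
        (monomial⊛-regrade {μ₁} {0} {k} {⊖ F}
          (Homogeneous-resp (≈-sym (⊛-⊖ (monomial μ₁ 0) F))
            (Homogeneous-⊖ (Homogeneous-resp (≐⇒≈ (⊛-congˡ F (pow-X μ₁))) xF-homog))) 0 (N ∸ μ₂) i j
          λ on → off (regrade {i + j} {μ₂} {μ₁} μ₂≤N (trans (cong (_+_ (i + j)) (sym (+-identityʳ μ₁))) on)))
      where
      open ≡-Reasoning
      regrade : ∀ {s a b} → a ≤ N → s + b ≡ k + (N ∸ a) → s + (b + a) ≡ k + N
      regrade {s} {a} {b} a≤N s+b≡ = begin
        s + (b + a)          ≡⟨ +-assoc s b a ⟨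
        s + b + a            ≡⟨ cong (_+ a) s+b≡ ⟩
        k + (N ∸ a) + a      ≡⟨ +-assoc k (N ∸ a) a ⟩
        k + (N ∸ a + a)      ≡⟨ cong (_+_ k) (m∸n+n≡m a≤N) ⟩
        k + N                ∎
      +-comm-middle : ∀ s a b → s + (a + b) ≡ s + (b + a)
      +-comm-middle s a b = cong (_+_ s) (+-comm a b)

    -- The dual of a homogeneous basis element of degree k has degree k + p^d - μ₁ - μ₂;
    -- the alternative, that all its coefficients vanish, is excluded as it belongs to a basis.
    dual-degree : ∀ {μ₁ μ₂ μ₃ F G k θ′} → InBox p d (μ₁ , μ₂ , μ₃) → HomogeneousD k (mkθ (μ₁ , μ₂ , μ₃) F G) →
      IsBasis p (dualMult p d (μ₁ , μ₂ , μ₃)) (mkθ (dualMult p d (μ₁ , μ₂ , μ₃)) G (⊖ F)) θ′ →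
      Σ ℕ λ k∨ → HomogeneousD k∨ (mkθ (dualMult p d (μ₁ , μ₂ , μ₃)) G (⊖ F)) × k∨ + (μ₁ + μ₂) ≡ k + p ^ d
    dual-degree {μ₁} {μ₂} {μ₃} {F} {G} {k} {θ′} (μ₁≤N , μ₂≤N , _) θ-homog dual-basis with μ₁ + μ₂ ≤? k + N
    ... | yes c≤m = k + N ∸ (μ₁ + μ₂) , ((λ i j → proj₁ ∘ vanishes′ i j) , (λ i j → proj₂ ∘ vanishes′ i j)) , m∸n+n≡m c≤m
      where
      vanishes′ : ∀ i j → i + j ≢ k + N ∸ (μ₁ + μ₂) → ((pow X (N ∸ μ₁) ⊛ G) i j ~ + 0) × ((pow Y (N ∸ μ₂) ⊛ ⊖ F) i j ~ + 0)
      vanishes′ i j i+j≢ = mkθ-dual-vanishes {μ₁} {μ₂} {μ₃} {F} {G} {k} μ₁≤N μ₂≤N θ-homog i j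
        λ i+j+c≡m → i+j≢ (trans (sym (m+n∸n≡m (i + j) (μ₁ + μ₂))) (cong (_∸ (μ₁ + μ₂)) i+j+c≡m))
    ... | no  c≰m = ⊥-elim (IsBasis⇒≉0 p-prime ν {mkθ ν G (⊖ F)} {θ′} dual-basis
        (mk≈ (λ i j → proj₁ (vanishes i j)) , mk≈ (λ i j → proj₂ (vanishes i j))))
      where
      ν = dualMult p d (μ₁ , μ₂ , μ₃)
      vanishes : ∀ i j → ((pow X (N ∸ μ₁) ⊛ G) i j ~ + 0) × ((pow Y (N ∸ μ₂) ⊛ ⊖ F) i j ~ + 0)
      vanishes i j = mkθ-dual-vanishes {μ₁} {μ₂} {μ₃} {F} {G} {k} μ₁≤N μ₂≤N θ-homog i j
        λ i+j+c≡m → c≰m (subst (μ₁ + μ₂ ≤_) i+j+c≡m (m≤n+m (μ₁ + μ₂) (i + j)))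

    SameΔ-dual : ∀ {μ} → InBox p d μ → SameΔ p μ (dualMult p d μ)
    SameΔ-dual {μ@(μ₁ , μ₂ , μ₃)} μ∈box θ₁ θ₂ k₁ k₂ η₁ η₂ l₁ l₂ θ-basis θ₁-deg θ₂-deg η-basis η₁-deg η₂-deg =
      let F₁ , G₁ , F₁-poly , G₁-poly , θ₁≈ = InD⇒mkθ μ θ₁ (proj₁ θ-basis)
          F₂ , G₂ , F₂-poly , G₂-poly , θ₂≈ = InD⇒mkθ μ θ₂ (proj₁ (proj₂ θ-basis))
          dual-basis = IsBasis-dual {μ} {F₁} {G₁} {F₂} {G₂} μ∈box F₁-poly G₁-poly F₂-poly G₂-poly
                         (IsBasis-resp μ {θ₁} {mkθ μ F₁ G₁} {θ₂} {mkθ μ F₂ G₂} θ₁≈ θ₂≈ θ-basis)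
          k₁∨ , θ₁∨-homog , k₁∨+c≡k₁+N = dual-degree {μ₁} {μ₂} {μ₃} {F₁} {G₁} {k₁} {mkθ ν G₂ (⊖ F₂)} μ∈box
                                           (HomogeneousD-resp {k₁} {θ₁} θ₁≈ (HomogDeg⇒HomogeneousD θ₁ k₁ θ₁-deg)) dual-basis
          k₂∨ , θ₂∨-homog , k₂∨+c≡k₂+N = dual-degree {μ₁} {μ₂} {μ₃} {F₂} {G₂} {k₂} {mkθ ν G₁ (⊖ F₁)} μ∈box
                                           (HomogeneousD-resp {k₂} {θ₂} θ₂≈ (HomogDeg⇒HomogeneousD θ₂ k₂ θ₂-deg))
                                           (IsBasis-swap ν {mkθ ν G₁ (⊖ F₁)} {mkθ ν G₂ (⊖ F₂)} dual-basis)
      in begin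
        ∣ k₁ - k₂ ∣                                   ≡⟨ ∣m+o-n+o∣≡∣m-n∣ N k₁ k₂ ⟨
        ∣ k₁ + N - k₂ + N ∣                           ≡⟨ cong₂ ∣_-_∣ k₁∨+c≡k₁+N k₂∨+c≡k₂+N ⟨
        ∣ k₁∨ + (μ₁ + μ₂) - k₂∨ + (μ₁ + μ₂) ∣         ≡⟨ ∣m+o-n+o∣≡∣m-n∣ (μ₁ + μ₂) k₁∨ k₂∨ ⟩
        ∣ k₁∨ - k₂∨ ∣                                 ≡⟨ exponents-unique p-prime ν {mkθ ν G₁ (⊖ F₁)} {mkθ ν G₂ (⊖ F₂)} {k₁∨} {k₂∨}
                                                           {η₁} {η₂} {l₁} {l₂} dual-basis θ₁∨-homog θ₂∨-homog η-basis
                                                           (HomogDeg⇒HomogeneousD η₁ l₁ η₁-deg) (HomogDeg⇒HomogeneousD η₂ l₂ η₂-deg) ⟩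
        ∣ l₁ - l₂ ∣                                   ∎
      where
      open ≡-Reasoning
      ν = dualMult p d μ

theorem4p5 : (p d : ℕ) → Prime p → 0 < d → (μ : Mult) → InBox p d μ →
    (f g f' g' : Ser) → IsPoly p f → IsPoly p g → IsPoly p f' → IsPoly p g' →
    (IsBasis p μ (mkθ μ f g) (mkθ μ f' g')
      ⇔ IsBasis p (dualMult p d μ) (mkθ∨ p d μ f g) (mkθ∨ p d μ f' g'))
    × SameΔ p μ (dualMult p d μ)
theorem4p5 p d p-prime _ μ μ∈box f g f' g' f-poly g-poly f'-poly g'-poly =
  IsBasis-dual⇔ p p-prime d {μ} {f} {g} {f'} {g'} μ∈box f-poly g-poly f'-poly g'-poly ,
  SameΔ-dual p p-prime d {μ} μ∈box
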